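{- Let $G$ be a bipartite graph, let $C$ be a $4$-cycle of $G$, and let $r\ge 2$ be an integer. Let $\mathbb{H}(C,2r)$ be the set of all $2r$-Sachs subgraphs $H$ of $G$ in which $C$ is embedded. Then $$\sum_{H\in\mathbb{H}(C,2r)}(-1)^{o(H)}2^{c(H)}=0.$$
   Context: All graphs are finite, simple and undirected. A $p$-Sachs subgraph of $G$ is a subgraph $H$ of $G$ on $p$ vertices each of whose connected components is either a single edge ($K_2$) or a cycle. For a graph $H$, $o(H)$ denotes its number of connected components and $c(H)$ the number of its components that are cycles. For graphs $G_1=(V_1,E_1)$, $G_2=(V_2,E_2)$, $G_1\cup G_2=(V_1\cup V_2,E_1\cup E_2)$ and $G_1\cap G_2=(V_1\cap V_2,E_1\cap E_2)$. If $C$ is a cycle of length $2l$ and $H$ is a $2r$-Sachs subgraph with $r\ge l$, then $C$ is said to be embedded in $H$ if $C\cap H$ is a $2l$-Sachs subgraph and $C\cup H$ is a $2r$-Sachs subgraph. -}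

module Defs where

open import Data.Bool using (Bool; true; false; _∧_; _∨_; not; if_then_else_)
open import Data.Nat using (ℕ; zero; suc; _≡ᵇ_; _<ᵇ_)
open import Data.Fin using (Fin; toℕ)
open import Data.List using (List; []; _∷_; allFin; foldr; map)
open import Data.Bool.ListAction using (any; all)
open import Data.List.Relation.Unary.All using (All)
open import Data.List.Relation.Unary.Any using (Any)
open import Data.List.Relation.Unary.AllPairs using (AllPairs)
open import Data.List.Membership.Propositional using (_∈_)
open import Data.Integer using (ℤ; +_; -[1+_]; _*_; _+_; _^_)
open import Data.Product using (Σ; _×_; ∃)
open import Data.Sum using (_⊎_)
open import Relation.Nullary using (¬_)
open import Relation.Binary.PropositionalEquality using (_≡_; _≢_)

record Graph (n : ℕ) : Set where
  field
    adj    : Fin n → Fin n → Bool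
    sym    : ∀ u v → adj u v ≡ adj v u
    irrefl : ∀ v → adj v v ≡ false
open Graph public

record Sub (n : ℕ) : Set where
  constructor sub
  field
    vs : Fin n → Bool
    es : Fin n → Fin n → Bool
open Sub public

record IsSubgraph {n : ℕ} (G : Graph n) (H : Sub n) : Set where
  field
    es-sym : ∀ u v → es H u v ≡ es H v u
    es-adj : ∀ u v → es H u v ≡ true → adj G u v ≡ true
    es-vs  : ∀ u v → es H u v ≡ true → vs H u ≡ true

_≈_ : ∀ {n} → Sub n → Sub n → Set
H ≈ K = (∀ v → vs H v ≡ vs K v) × (∀ u v → es H u v ≡ es K u v)

_∪S_ : ∀ {n} → Sub n → Sub n → Sub n
H ∪S K = sub (λ v → vs H v ∨ vs K v) (λ u v → es H u v ∨ es K u v)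

_∩S_ : ∀ {n} → Sub n → Sub n → Sub n
H ∩S K = sub (λ v → vs H v ∧ vs K v) (λ u v → es H u v ∧ es K u v)

count : ∀ {n} → (Fin n → Bool) → ℕ
count {n} p = foldr (λ i k → if p i then suc k else k) zero (allFin n)

_==F_ : ∀ {n} → Fin n → Fin n → Bool
u ==F v = toℕ u ≡ᵇ toℕ v

_<F_ : ∀ {n} → Fin n → Fin n → Bool
u <F v = toℕ u <ᵇ toℕ v

order : ∀ {n} → Sub n → ℕ
order H = count (vs H)

deg : ∀ {n} → Sub n → Fin n → ℕ
deg H u = count (es H u)

reachB : ∀ {n} → Sub n → ℕ → Fin n → Fin n → Bool
reachB H zero    u v = vs H u ∧ (u ==F v)
reachB H (suc k) u v = reachB H k u v ∨ any (λ w → reachB H k u w ∧ es H w v) (allFin _)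

-- connectivity in H (walks of length ≤ n suffice on n vertices)
reach : ∀ {n} → Sub n → Fin n → Fin n → Bool
reach {n} H = reachB H n

-- the component of H containing v (as a graph) is K₂: it has exactly 2 vertices
compIsK2 : ∀ {n} → Sub n → Fin n → Set
compIsK2 H v = count (reach H v) ≡ 2

-- the component of H containing v is a cycle: it is a connected
-- 2-regular (finite simple) graph
compIsCycle : ∀ {n} → Sub n → Fin n → Set
compIsCycle H v = ∀ u → reach H v u ≡ true → deg H u ≡ 2

IsCycle : ∀ {n} → Sub n → Set
IsCycle H = (∃ λ v → vs H v ≡ true)
          × (∀ u v → vs H u ≡ true → vs H v ≡ true → reach H u v ≡ true)
          × (∀ v → vs H v ≡ true → deg H v ≡ 2)

compIsCycleB : ∀ {n} → Sub n → Fin n → Bool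
compIsCycleB H v = all (λ u → not (reach H v u) ∨ (deg H u ≡ᵇ 2)) (allFin _)

isRep : ∀ {n} → Sub n → Fin n → Bool
isRep H v = vs H v ∧ not (any (λ u → (u <F v) ∧ reach H v u) (allFin _))

-- o(H): number of connected components (one least representative each)
o : ∀ {n} → Sub n → ℕ
o H = count (isRep H)

c : ∀ {n} → Sub n → ℕ
c H = count (λ v → isRep H v ∧ compIsCycleB H v)

IsSachs : ∀ {n} → Graph n → ℕ → Sub n → Set
IsSachs G p H = IsSubgraph G H × order H ≡ p
              × (∀ v → vs H v ≡ true → compIsK2 H v ⊎ compIsCycle H v)

Embedded : ∀ {n} → Graph n → ℕ → ℕ → Sub n → Sub n → Set
Embedded G l r C H = IsSachs G (2 Data.Nat.* l) (C ∩S H)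
                   × IsSachs G (2 Data.Nat.* r) (C ∪S H)

InH : ∀ {n} → Graph n → Sub n → ℕ → Sub n → Set
InH G C r H = IsSachs G (2 Data.Nat.* r) H × Embedded G 2 r C H

Bipartite : ∀ {n} → Graph n → Set
Bipartite {n} G = ∃ λ (col : Fin n → Bool) →
  ∀ u v → adj G u v ≡ true → col u ≢ col v

Enumerates : ∀ {n} → (Sub n → Set) → List (Sub n) → Set
Enumerates P L = All P L
               × (∀ H → P H → Any (H ≈_) L)
               × AllPairs (λ H K → ¬ (H ≈ K)) L

weight : ∀ {n} → Sub n → ℤ
weight H = (-[1+ 0 ] ^ o H) * (+ (2 Data.Nat.^ c H))

sumℤ : List ℤ → ℤ
sumℤ = foldr _+_ (+ 0)

-- Every H in ℍ(C,2r) contains the four corners of C, and its edges at the corners are edges of C: the component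
-- of a corner in C ∪ H contains both C-neighbours, so it is a cycle, and the corner already has degree 2 in C.
-- As C ∩ H is a Sachs subgraph, these edges form one of the perfect matchings {c₀c₁, c₂c₃}, {c₁c₂, c₃c₀}
-- or all of C.
-- Exchanging this part of H for each of the three possibilities yields three members of ℍ(C,2r) with the same
-- components away from C. Writing s = (-1)^{o} and t = 2^{c} for what those components contribute, the three
-- weights are s·t, s·t and (-s)·2t, so ℍ(C,2r) splits into triples of total weight zero.
module Submission where

open import Defs
open import Data.Nat using (ℕ; _≤_)
open import Data.List using (List; map)
open import Data.Integer using (ℤ; +_)
open import Relation.Binary.PropositionalEquality using (_≡_)

open import Data.Bool as Bool using (Bool; true; false; _∧_; _∨_; not; if_then_else_; T)
open import Data.Bool.Properties
  using (∧-conicalˡ; ∧-conicalʳ; ∨-conicalˡ; ∧-comm; ∨-comm; ∨-zeroʳ; ∧-zeroʳ; ∨-identityʳ; ∧-identityʳ;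
         ∨-inverseʳ; ∧-inverseʳ; ¬-not; not-injective; T-≡)
open import Data.Bool.ListAction using (any; all)
open import Data.Nat as Nat using (zero; suc; _<_; _≡ᵇ_; _<ᵇ_; z≤n; s≤s)
open import Data.Nat.Properties as ℕ using (≡ᵇ⇒≡; ≡⇒≡ᵇ; <ᵇ⇒<; <⇒<ᵇ)
open import Data.Fin using (Fin; toℕ; _≟_)
open import Data.Fin.Properties using (toℕ-injective; toℕ<n; all?)
open import Data.List using ([]; _∷_; foldr; allFin; length)
open import Data.List.Properties using (map-tabulate)
open import Data.List.Membership.Propositional using (_∈_)
open import Data.List.Membership.Propositional.Properties using (∈-allFin)
open import Data.List.Relation.Unary.All as All using (All; []; _∷_)
open import Data.List.Relation.Unary.Any using (Any; here; there)
open import Data.List.Relation.Unary.AllPairs using (AllPairs; []; _∷_)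
open import Data.List.Relation.Unary.Unique.Propositional using (Unique)
open import Data.Product using (∃; _×_; _,_; proj₁; proj₂)
open import Data.Sum using (_⊎_; inj₁; inj₂)
open import Data.Empty using (⊥; ⊥-elim)
open import Function using (_∘_; id; case_of_; Equivalence)
open import Relation.Nullary using (¬_; Dec; yes; no; _×-dec_; _⊎-dec_)
open import Relation.Nullary.Decidable using (⌊_⌋; toWitness)
open import Relation.Binary.Definitions using (DecidableEquality)
open import Data.Maybe using (Maybe; just; nothing; is-just; maybe′)
open import Data.Maybe.Properties using (≡-dec)
open import Relation.Binary using (Decidable; DecSetoid)
open import Level using (0ℓ)
open import Data.Integer using (-1ℤ; _^_; _+_; _*_)
import Data.Integer as ℤ
import Data.Integer.Properties as ℤ
open import Data.Integer.Tactic.RingSolver using (solve-∀)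
open import Algebra.Properties.CommutativeSemigroup ℤ.+-commutativeSemigroup using (interchange)
open import Relation.Binary using (tri<; tri≈; tri>)
open import Relation.Binary.PropositionalEquality using (refl; trans; cong; cong₂; subst; _≢_)
import Relation.Binary.PropositionalEquality as ≡
open ≡.≡-Reasoning

∧-trueˡ : ∀ {x y} → x ∧ y ≡ true → x ≡ true
∧-trueˡ {x} {y} = ∧-conicalˡ x y

∧-trueʳ : ∀ {x y} → x ∧ y ≡ true → y ≡ true
∧-trueʳ {x} {y} = ∧-conicalʳ x y

∧-true : ∀ {x y} → x ≡ true → y ≡ true → x ∧ y ≡ true
∧-true refl refl = refl

∨-true : ∀ {x y} → x ∨ y ≡ true → x ≡ true ⊎ y ≡ true
∨-true {true}  _ = inj₁ refl
∨-true {false} e = inj₂ e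

∨-trueˡ : ∀ {x y} → x ≡ true → x ∨ y ≡ true
∨-trueˡ refl = refl

∨-trueʳ : ∀ {x y} → y ≡ true → x ∨ y ≡ true
∨-trueʳ {x} refl = ∨-zeroʳ x

true≢false : ∀ {x} → x ≡ true → x ≢ false
true≢false refl ()

≢true⇒≡false : ∀ {x} → x ≢ true → x ≡ false
≢true⇒≡false = ¬-not

true⇔true⇒≡ : ∀ {x y} → (x ≡ true → y ≡ true) → (y ≡ true → x ≡ true) → x ≡ y
true⇔true⇒≡ {true}           f _ = ≡.sym (f refl)
true⇔true⇒≡ {false} {true}  _ g = g refl
true⇔true⇒≡ {false} {false} _ _ = refl

case-bool : ∀ (b : Bool) {P : Set} → (b ≡ true → P) → (b ≡ false → P) → P
case-bool true  f _ = f refl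
case-bool false _ g = g refl

if-split : ∀ {A : Set} b {x y z : A} → (b ≡ true → z ≡ x) → (b ≡ false → z ≡ y) → z ≡ (if b then x else y)
if-split true  f _ = f refl
if-split false _ g = g refl

∧-⇒-absorb : ∀ {x y} → (x ≡ true → y ≡ true) → x ∧ y ≡ x
∧-⇒-absorb {true}  x⇒y = x⇒y refl
∧-⇒-absorb {false} _   = refl

∨-⇒-absorb : ∀ {x y} → (x ≡ true → y ≡ true) → x ∨ y ≡ y
∨-⇒-absorb {true}  x⇒y = ≡.sym (x⇒y refl)
∨-⇒-absorb {false} _   = refl

T⇒≡true : ∀ {b} → T b → b ≡ true
T⇒≡true = Equivalence.to T-≡

≡true⇒T : ∀ {b} → b ≡ true → T b
≡true⇒T = Equivalence.from T-≡

==F-refl : ∀ {n} (v : Fin n) → (v ==F v) ≡ true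
==F-refl v = T⇒≡true (≡⇒≡ᵇ (toℕ v) (toℕ v) refl)

==F⇒≡ : ∀ {n} {u v : Fin n} → (u ==F v) ≡ true → u ≡ v
==F⇒≡ {u = u} {v} e = toℕ-injective (≡ᵇ⇒≡ (toℕ u) (toℕ v) (≡true⇒T e))

≢⇒==F-false : ∀ {n} {u v : Fin n} → u ≢ v → (u ==F v) ≡ false
≢⇒==F-false u≢v = ≢true⇒≡false (u≢v ∘ ==F⇒≡)

<F⇒< : ∀ {n} {u v : Fin n} → (u <F v) ≡ true → toℕ u < toℕ v
<F⇒< {u = u} {v} e = <ᵇ⇒< (toℕ u) (toℕ v) (≡true⇒T e)

<⇒<F : ∀ {n} {u v : Fin n} → toℕ u < toℕ v → (u <F v) ≡ true
<⇒<F u<v = T⇒≡true (<⇒<ᵇ u<v)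

module _ {A : Set} where

  any-intro : ∀ {p : A → Bool} {xs x} → x ∈ xs → p x ≡ true → any p xs ≡ true
  any-intro {p} {y ∷ _} (here refl) e = ∨-trueˡ e
  any-intro {p} {y ∷ _} (there x∈) e = ∨-trueʳ {p y} (any-intro x∈ e)

  any-elim : ∀ {p : A → Bool} xs → any p xs ≡ true → ∃ λ x → p x ≡ true
  any-elim {p} (x ∷ xs) e with p x in px
  ... | true  = x , px
  ... | false = any-elim xs e

  all-intro : ∀ {p : A → Bool} xs → (∀ x → p x ≡ true) → all p xs ≡ true
  all-intro []       _ = refl
  all-intro (x ∷ xs) h = ∧-true (h x) (all-intro xs h)

  all-elim : ∀ {p : A → Bool} {xs x} → all p xs ≡ true → x ∈ xs → p x ≡ true
  all-elim e (here refl) = ∧-trueˡ e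
  all-elim {p} {y ∷ _} e (there x∈) = all-elim (∧-trueʳ {p y} e) x∈

  any-cong : ∀ {p q : A → Bool} xs → (∀ x → p x ≡ q x) → any p xs ≡ any q xs
  any-cong []       _ = refl
  any-cong (x ∷ xs) h = cong₂ _∨_ (h x) (any-cong xs h)

  all-cong : ∀ {p q : A → Bool} xs → (∀ x → p x ≡ q x) → all p xs ≡ all q xs
  all-cong []       _ = refl
  all-cong (x ∷ xs) h = cong₂ _∧_ (h x) (all-cong xs h)

all-allFin-false : ∀ {n} {p : Fin n → Bool} (i : Fin n) → p i ≡ false → all p (allFin n) ≡ false
all-allFin-false i e = ≢true⇒≡false λ a → true≢false (all-elim a (∈-allFin i)) e

tally : ∀ {A : Set} → (A → Bool) → List A → ℕ
tally p = foldr (λ i k → if p i then suc k else k) zero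

module _ {A : Set} where

  tally-cong : ∀ {p q : A → Bool} xs → (∀ x → p x ≡ q x) → tally p xs ≡ tally q xs
  tally-cong []       _ = refl
  tally-cong (x ∷ xs) h rewrite h x | tally-cong xs h = refl

  tally-mono : ∀ {p q : A → Bool} xs → (∀ x → p x ≡ true → q x ≡ true) → tally p xs ≤ tally q xs
  tally-mono []       _ = z≤n
  tally-mono {p} {q} (x ∷ xs) h with p x in px | q x in qx
  ... | true  | true  = s≤s (tally-mono xs h)
  ... | true  | false = ⊥-elim (true≢false (h x px) qx)
  ... | false | true  = ℕ.m≤n⇒m≤1+n (tally-mono xs h)
  ... | false | false = tally-mono xs h

  tally-⊆-≡ : ∀ {p q : A → Bool} {xs x} → (∀ x → p x ≡ true → q x ≡ true) → tally p xs ≡ tally q xs →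
    x ∈ xs → q x ≡ true → p x ≡ true
  tally-⊆-≡ {p} {q} {y ∷ xs} h e x∈ qx with p y in py | q y in qy | x∈
  ... | true  | _     | here refl = py
  ... | true  | true  | there x∈′ = tally-⊆-≡ h (ℕ.suc-injective e) x∈′ qx
  ... | true  | false | _         = ⊥-elim (true≢false (h y py) qy)
  ... | false | true  | _         = ⊥-elim (ℕ.<-irrefl e (s≤s (tally-mono xs h)))
  ... | false | false | here refl = ⊥-elim (true≢false qx qy)
  ... | false | false | there x∈′ = tally-⊆-≡ h e x∈′ qx

  tally-∨ : ∀ {p q : A → Bool} xs → (∀ x → p x ∧ q x ≡ false) →
    tally (λ x → p x ∨ q x) xs ≡ tally p xs Nat.+ tally q xs
  tally-∨ []       _ = refl
  tally-∨ {p} {q} (x ∷ xs) h with p x in px | q x in qx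
  ... | true  | true  = ⊥-elim (true≢false (∧-true px qx) (h x))
  ... | true  | false = cong suc (tally-∨ xs h)
  ... | false | true  = trans (cong suc (tally-∨ xs h)) (≡.sym (ℕ.+-suc _ _))
  ... | false | false = tally-∨ xs h

  tally-false : ∀ {p : A → Bool} xs → (∀ x → p x ≡ false) → tally p xs ≡ 0
  tally-false []       _ = refl
  tally-false (x ∷ xs) h rewrite h x = tally-false xs h

  tally-pos : ∀ {p : A → Bool} {k} xs → tally p xs ≡ suc k → ∃ λ x → p x ≡ true
  tally-pos {p} (x ∷ xs) e with p x in px
  ... | true  = x , px
  ... | false = tally-pos xs e

  tally-map : ∀ {B : Set} (p : B → Bool) (f : A → B) xs → tally p (map f xs) ≡ tally (p ∘ f) xs
  tally-map p f []       = refl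
  tally-map p f (x ∷ xs) rewrite tally-map p f xs = refl

module _ {n : ℕ} where

  count-cong : ∀ {p q : Fin n → Bool} → (∀ i → p i ≡ q i) → count p ≡ count q
  count-cong = tally-cong (allFin n)

  count-mono : ∀ {p q : Fin n → Bool} → (∀ i → p i ≡ true → q i ≡ true) → count p ≤ count q
  count-mono = tally-mono (allFin n)

  count-⊆-≡ : ∀ {p q : Fin n → Bool} → (∀ i → p i ≡ true → q i ≡ true) → count p ≡ count q →
    ∀ i → q i ≡ true → p i ≡ true
  count-⊆-≡ h e i = tally-⊆-≡ h e (∈-allFin i)

  count-∨ : ∀ {p q : Fin n → Bool} → (∀ i → p i ∧ q i ≡ false) →
    count (λ i → p i ∨ q i) ≡ count p Nat.+ count q
  count-∨ = tally-∨ (allFin n)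

  count-false : ∀ {p : Fin n → Bool} → (∀ i → p i ≡ false) → count p ≡ 0
  count-false = tally-false (allFin n)

  count-pos : ∀ {p : Fin n → Bool} {k} → count p ≡ suc k → ∃ λ i → p i ≡ true
  count-pos = tally-pos (allFin n)

count-==F : ∀ {n} (v : Fin n) → count (_==F v) ≡ 1
count-==F {suc n} v = trans (cong (λ xs → tally (_==F v) (Fin.zero ∷ xs)) (≡.sym (map-tabulate id Fin.suc))) (go v)
  where
  go : ∀ v → tally (_==F v) (Fin.zero ∷ map Fin.suc (allFin n)) ≡ 1
  go Fin.zero    = cong suc (trans (tally-map _ Fin.suc (allFin n)) (count-false {n} (λ _ → refl)))
  go (Fin.suc v) = trans (tally-map _ Fin.suc (allFin n)) (count-==F v)

count-≤1 : ∀ {n} {p : Fin n → Bool} (x : Fin n) → (∀ i → p i ≡ true → i ≡ x) → count p ≤ 1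
count-≤1 {p = p} x h = subst (count p ≤_) (count-==F x)
  (count-mono λ i pi → subst (λ z → (i ==F z) ≡ true) (h i pi) (==F-refl i))

count-restrict : ∀ {n} {b p : Fin n → Bool} → (∀ v → p v ≡ true → b v ≡ true) →
  count (λ v → b v ∧ p v) ≡ count p
count-restrict {b = b} {p} p⊆b = count-cong λ v → case-bool (p v)
  (λ pv → trans (cong₂ _∧_ (p⊆b v pv) pv) (≡.sym pv))
  (λ ¬pv → trans (cong (b v ∧_) ¬pv) (trans (∧-zeroʳ (b v)) (≡.sym ¬pv)))

count-if : ∀ {n} (b p q : Fin n → Bool) →
  count (λ v → if b v then p v else q v) ≡ count (λ v → b v ∧ p v) Nat.+ count (λ v → not (b v) ∧ q v)
count-if b p q = trans (count-cong split) (count-∨ disjoint)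
  where
  split : ∀ v → (if b v then p v else q v) ≡ (b v ∧ p v) ∨ (not (b v) ∧ q v)
  split v with b v
  ... | true  = ≡.sym (∨-identityʳ (p v))
  ... | false = refl
  disjoint : ∀ v → (b v ∧ p v) ∧ (not (b v) ∧ q v) ≡ false
  disjoint v with b v
  ... | true  = ∧-zeroʳ (p v)
  ... | false = refl

count≡2⇒other : ∀ {n} {p : Fin n → Bool} {x : Fin n} → count p ≡ 2 → p x ≡ true →
  ∃ λ y → y ≢ x × p y ≡ true
count≡2⇒other {n} {p} {x} c₂ px with count-pos {p = others} {k = 0} count-others
  where
  others : Fin n → Bool
  others i = p i ∧ not (i ==F x)
  split : ∀ i → p i ≡ ((i ==F x) ∨ others i)
  split i with i ==F x in e
  ... | true  = trans (cong p (==F⇒≡ e)) px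
  ... | false = ≡.sym (∧-identityʳ (p i))
  disjoint : ∀ i → (i ==F x) ∧ others i ≡ false
  disjoint i with i ==F x
  ... | true  = ∧-zeroʳ (p i)
  ... | false = refl
  count-others : count others ≡ 1
  count-others = ℕ.+-cancelˡ-≡ 1 _ _
    (trans (≡.sym (trans (count-cong split) (trans (count-∨ disjoint) (cong (Nat._+ count others) (count-==F x))))) c₂)
... | y , h = y , (λ { refl → true≢false (∧-trueʳ {p y} h) (cong not (==F-refl y)) }) , ∧-trueˡ h

_∈ᵇ_ : ∀ {n} → Fin n → List (Fin n) → Bool
i ∈ᵇ xs = any (i ==F_) xs

module _ {n : ℕ} where

  ∈ᵇ⇒∈ : ∀ {x : Fin n} {xs} → (x ∈ᵇ xs) ≡ true → x ∈ xs
  ∈ᵇ⇒∈ {xs = y ∷ ys} e with ∨-true e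
  ... | inj₁ x≡y = here (==F⇒≡ x≡y)
  ... | inj₂ x∈  = there (∈ᵇ⇒∈ x∈)

  count-∈ᵇ : ∀ {xs : List (Fin n)} → Unique xs → count (_∈ᵇ xs) ≡ length xs
  count-∈ᵇ {[]}     []        = count-false {n} {p = _∈ᵇ []} (λ _ → refl)
  count-∈ᵇ {x ∷ xs} (x∉ ∷ u) =
    trans (count-∨ {n} {p = _==F x} disjoint) (cong₂ Nat._+_ (count-==F x) (count-∈ᵇ u))
    where
    disjoint : ∀ i → (i ==F x) ∧ (i ∈ᵇ xs) ≡ false
    disjoint i = ≢true⇒≡false λ e →
      All.lookup x∉ (∈ᵇ⇒∈ {x = i} (∧-trueʳ {i ==F x} e)) (≡.sym (==F⇒≡ (∧-trueˡ {i ==F x} e)))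

  length≤count : ∀ {p : Fin n → Bool} {xs} → Unique xs → All (λ x → p x ≡ true) xs → length xs ≤ count p
  length≤count {p} u pxs =
    subst (_≤ count p) (count-∈ᵇ u) (count-mono {n} λ i e → All.lookup pxs (∈ᵇ⇒∈ {x = i} e))

  count≡length⇒∈ : ∀ {p : Fin n → Bool} {xs} → count p ≡ length xs → Unique xs →
    All (λ x → p x ≡ true) xs → ∀ z → p z ≡ true → z ∈ xs
  count≡length⇒∈ e u pxs z pz = ∈ᵇ⇒∈
    (count-⊆-≡ {n} (λ i i∈ → All.lookup pxs (∈ᵇ⇒∈ {x = i} i∈)) (trans (count-∈ᵇ u) (≡.sym e)) z pz)

isMin : ∀ {n} → (Fin n → Bool) → Fin n → Bool
isMin S v = S v ∧ not (any (λ u → (u <F v) ∧ S u) (allFin _))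

module _ {n : ℕ} (S : Fin n → Bool) where

  isMin-exists : ∀ b (x : Fin n) → toℕ x ≤ b → S x ≡ true → ∃ λ m → isMin S m ≡ true
  isMin-exists b x x≤b sx with any (λ u → (u <F x) ∧ S u) (allFin n) in smaller
  ... | false = x , ∧-true sx (cong not smaller)
  ... | true with any-elim (allFin n) smaller
  ...   | u , h with b
  ...     | zero   = ⊥-elim (ℕ.n≮0 (ℕ.<-≤-trans (<F⇒< (∧-trueˡ h)) x≤b))
  ...     | suc b′ = isMin-exists b′ u (ℕ.≤-pred (ℕ.<-≤-trans (<F⇒< (∧-trueˡ h)) x≤b)) (∧-trueʳ {u <F x} h)

  isMin-unique : ∀ {m₁ m₂} → isMin S m₁ ≡ true → isMin S m₂ ≡ true → m₁ ≡ m₂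
  isMin-unique {m₁} {m₂} h₁ h₂ with ℕ.<-cmp (toℕ m₁) (toℕ m₂)
  ... | tri≈ _ e _ = toℕ-injective e
  ... | tri< m₁<m₂ _ _ = ⊥-elim (below m₁<m₂ h₁ h₂)
    where
    below : ∀ {m m′} → toℕ m < toℕ m′ → isMin S m ≡ true → isMin S m′ ≡ true → ⊥
    below {m} {m′} lt h h′ = true≢false (any-intro (∈-allFin m) (∧-true (<⇒<F lt) (∧-trueˡ h)))
                                        (not-injective (∧-trueʳ {S m′} h′))
  ... | tri> _ _ m₂<m₁ = ⊥-elim (true≢false (any-intro (∈-allFin m₂) (∧-true (<⇒<F m₂<m₁) (∧-trueˡ h₂)))
                                           (not-injective (∧-trueʳ {S m₁} h₁)))

  count-isMin : ∀ {x} → S x ≡ true → count (isMin S) ≡ 1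
  count-isMin {x} sx with isMin-exists (toℕ x) x ℕ.≤-refl sx
  ... | m , hm = trans (count-cong λ v → true⇔true⇒≡
                         (λ h → subst (λ z → (v ==F z) ≡ true) (isMin-unique h hm) (==F-refl v))
                         (λ e → subst (λ z → isMin S z ≡ true) (≡.sym (==F⇒≡ e)) hm))
                       (count-==F m)

-- Reachability and components

module _ {n : ℕ} (X : Sub n) where

  reachB-closed : ∀ (S : Fin n → Bool) → (∀ u w → S u ≡ true → es X u w ≡ true → S w ≡ true) →
    ∀ k {v u} → S v ≡ true → reachB X k v u ≡ true → S u ≡ true
  reachB-closed S closed zero {v} sv e = trans (cong S (≡.sym (==F⇒≡ (∧-trueʳ {vs X v} e)))) sv
  reachB-closed S closed (suc k) {v} {u} sv e with ∨-true e
  ... | inj₁ h = reachB-closed S closed k sv h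
  ... | inj₂ h with any-elim {p = λ w → reachB X k v w ∧ es X w u} (allFin n) h
  ...   | w , hw = closed w u (reachB-closed S closed k sv (∧-trueˡ hw)) (∧-trueʳ {reachB X k v w} hw)

  reachB-refl : ∀ k {v} → vs X v ≡ true → reachB X k v v ≡ true
  reachB-refl zero    {v} h = ∧-true h (==F-refl v)
  reachB-refl (suc k)     h = ∨-trueˡ (reachB-refl k h)

  reachB-step : ∀ k {v w u} → reachB X k v w ≡ true → es X w u ≡ true → reachB X (suc k) v u ≡ true
  reachB-step k {v} {w} {u} h e = ∨-trueʳ {reachB X k v u} (any-intro (∈-allFin w) (∧-true h e))

  reachB-mono : ∀ {k m v u} → k ≤ m → reachB X k v u ≡ true → reachB X m v u ≡ true
  reachB-mono {zero}  {zero}          z≤n h = h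
  reachB-mono {zero}  {suc m}         z≤n h = ∨-trueˡ (reachB-mono {zero} {m} z≤n h)
  reachB-mono {suc k} {suc m} {v} {u} (s≤s k≤m) h with ∨-true h
  ... | inj₁ h′ = reachB-mono (ℕ.m≤n⇒m≤1+n k≤m) h′
  ... | inj₂ h′ with any-elim {p = λ w → reachB X k v w ∧ es X w u} (allFin n) h′
  ...   | w , hw = reachB-step m (reachB-mono k≤m (∧-trueˡ hw)) (∧-trueʳ {reachB X k v w} hw)

  reach-closed : ∀ (S : Fin n → Bool) → (∀ u w → S u ≡ true → es X u w ≡ true → S w ≡ true) →
    ∀ {v u} → S v ≡ true → reach X v u ≡ true → S u ≡ true
  reach-closed S closed = reachB-closed S closed n

  reach-refl : ∀ {v} → vs X v ≡ true → reach X v v ≡ true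
  reach-refl = reachB-refl n

  reach-edge : ∀ {v u} → vs X v ≡ true → es X v u ≡ true → reach X v u ≡ true
  reach-edge {v} h e = reachB-mono (ℕ.≤-<-trans z≤n (toℕ<n v)) (reachB-step 0 (reachB-refl 0 h) e)

  reach-path₂ : 2 ≤ n → ∀ {v w u} → vs X v ≡ true → es X v w ≡ true → es X w u ≡ true →
    reach X v u ≡ true
  reach-path₂ 2≤n h e₁ e₂ = reachB-mono 2≤n (reachB-step 1 (reachB-step 0 (reachB-refl 0 h) e₁) e₂)

reachB-local : ∀ {n} (X Y : Sub n) (S : Fin n → Bool) →
  (∀ u w → S u ≡ true → es Y u w ≡ true → S w ≡ true) →
  (∀ u → S u ≡ true → vs X u ≡ vs Y u) → (∀ u w → S u ≡ true → es X u w ≡ es Y u w) →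
  ∀ k {v} u → S v ≡ true → reachB X k v u ≡ reachB Y k v u
reachB-local X Y S closed vs≡ es≡ zero    {v} u sv = cong (_∧ (v ==F u)) (vs≡ v sv)
reachB-local X Y S closed vs≡ es≡ (suc k) {v} u sv =
  cong₂ _∨_ (reachB-local X Y S closed vs≡ es≡ k u sv) (any-cong (allFin _) step)
  where
  step : ∀ w → (reachB X k v w ∧ es X w u) ≡ (reachB Y k v w ∧ es Y w u)
  step w rewrite reachB-local X Y S closed vs≡ es≡ k w sv with reachB Y k v w in r
  ... | false = refl
  ... | true  = es≡ w u (reachB-closed Y S closed k sv r)

reach-local : ∀ {n} (X Y : Sub n) (S : Fin n → Bool) →
  (∀ u w → S u ≡ true → es Y u w ≡ true → S w ≡ true) →
  (∀ u → S u ≡ true → vs X u ≡ vs Y u) → (∀ u w → S u ≡ true → es X u w ≡ es Y u w) →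
  ∀ {v} u → S v ≡ true → reach X v u ≡ reach Y v u
reach-local {n} X Y S closed vs≡ es≡ = reachB-local X Y S closed vs≡ es≡ n

isRep-cong : ∀ {n} {X Y : Sub n} {v} → vs X v ≡ vs Y v → (∀ u → reach X v u ≡ reach Y v u) →
  isRep X v ≡ isRep Y v
isRep-cong {v = v} vs≡ reach≡ =
  cong₂ _∧_ vs≡ (cong not (any-cong (allFin _) λ u → cong ((u <F v) ∧_) (reach≡ u)))

compIsCycleB-cong : ∀ {n} {X Y : Sub n} {v} → (∀ u → reach X v u ≡ reach Y v u) →
  (∀ u → reach X v u ≡ true → deg X u ≡ deg Y u) → compIsCycleB X v ≡ compIsCycleB Y v
compIsCycleB-cong {X = X} {Y} {v} reach≡ deg≡ = all-cong (allFin _) step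
  where
  step : ∀ u → (not (reach X v u) ∨ (deg X u ≡ᵇ 2)) ≡ (not (reach Y v u) ∨ (deg Y u ≡ᵇ 2))
  step u rewrite ≡.sym (reach≡ u) with reach X v u in r
  ... | false = refl
  ... | true  = cong (_≡ᵇ 2) (deg≡ u r)

record Component {n} (X : Sub n) (S : Fin n → Bool) : Set where
  field
    ⊆vs          : ∀ v → S v ≡ true → vs X v ≡ true
    reach-within : ∀ {v} u → S v ≡ true → reach X v u ≡ S u
    inhabitant   : Fin n
    inhabited    : S inhabitant ≡ true

module _ {n} {X : Sub n} {S : Fin n → Bool} (comp : Component X S) where
  open Component comp

  isRep-in-component : ∀ v → S v ∧ isRep X v ≡ isMin S v
  isRep-in-component v = case-bool (S v)
    (λ sv → trans (cong (_∧ isRep X v) sv) (cong₂ (λ a b → a ∧ not b) (trans (⊆vs v sv) (≡.sym sv))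
                                              (any-cong (allFin n) λ u → cong ((u <F v) ∧_) (reach-within u sv))))
    (λ ¬sv → trans (cong (_∧ isRep X v) ¬sv)
                   (cong (λ a → a ∧ not (any (λ u → (u <F v) ∧ S u) (allFin n))) (≡.sym ¬sv)))

  count-isRep-in-component : count (λ v → S v ∧ isRep X v) ≡ 1
  count-isRep-in-component = trans (count-cong isRep-in-component) (count-isMin S inhabited)

isRep⇒vs : ∀ {n} (X : Sub n) v → isRep X v ≡ true → vs X v ≡ true
isRep⇒vs X v = ∧-trueˡ

o-one-component : ∀ {n} {X : Sub n} {S} → Component X S → (∀ v → vs X v ≡ true → S v ≡ true) → o X ≡ 1
o-one-component {X = X} comp vs⊆S =
  trans (≡.sym (count-restrict λ v r → vs⊆S v (isRep⇒vs X v r))) (count-isRep-in-component comp)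

o-two-components : ∀ {n} {X : Sub n} {S₁ S₂} → Component X S₁ → Component X S₂ →
  (∀ v → vs X v ≡ true → S₁ v ∨ S₂ v ≡ true) → (∀ v → S₁ v ∧ S₂ v ≡ false) → o X ≡ 2
o-two-components {X = X} {S₁} {S₂} comp₁ comp₂ cover disjoint =
  trans (count-cong split) (trans (count-∨ disjoint′)
        (cong₂ Nat._+_ (count-isRep-in-component comp₁) (count-isRep-in-component comp₂)))
  where
  split : ∀ v → isRep X v ≡ (S₁ v ∧ isRep X v) ∨ (S₂ v ∧ isRep X v)
  split v = case-bool (isRep X v)
    (λ r → trans r (≡.sym (trans (cong (λ b → (S₁ v ∧ b) ∨ (S₂ v ∧ b)) r)
                                 (trans (cong₂ _∨_ (∧-identityʳ (S₁ v)) (∧-identityʳ (S₂ v)))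
                                        (cover v (isRep⇒vs X v r))))))
    (λ ¬r → trans ¬r (≡.sym (trans (cong (λ b → (S₁ v ∧ b) ∨ (S₂ v ∧ b)) ¬r)
                                   (cong₂ _∨_ (∧-zeroʳ (S₁ v)) (∧-zeroʳ (S₂ v))))))
  disjoint′ : ∀ v → (S₁ v ∧ isRep X v) ∧ (S₂ v ∧ isRep X v) ≡ false
  disjoint′ v = case-bool (S₁ v)
    (λ s₁ → case-bool (S₂ v) (λ s₂ → ⊥-elim (true≢false (∧-true s₁ s₂) (disjoint v)))
                            (λ ¬s₂ → trans (cong (λ b → (S₁ v ∧ isRep X v) ∧ (b ∧ isRep X v)) ¬s₂)
                                           (∧-zeroʳ _)))
    (λ ¬s₁ → cong (λ b → (b ∧ isRep X v) ∧ (S₂ v ∧ isRep X v)) ¬s₁)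

module _ {n : ℕ} where

  ≈-refl : ∀ {H : Sub n} → H ≈ H
  ≈-refl = (λ _ → refl) , (λ _ _ → refl)

  ≈-sym : ∀ {H K : Sub n} → H ≈ K → K ≈ H
  ≈-sym (vs≡ , es≡) = (λ v → ≡.sym (vs≡ v)) , (λ u v → ≡.sym (es≡ u v))

  ≈-trans : ∀ {H K L : Sub n} → H ≈ K → K ≈ L → H ≈ L
  ≈-trans (vs≡ , es≡) (vs≡′ , es≡′) =
    (λ v → trans (vs≡ v) (vs≡′ v)) , (λ u v → trans (es≡ u v) (es≡′ u v))

  _≈?_ : Decidable (_≈_ {n})
  H ≈? K = all? (λ v → vs H v Bool.≟ vs K v) ×-dec all? (λ u → all? λ v → es H u v Bool.≟ es K u v)

  subDecSetoid : DecSetoid 0ℓ 0ℓ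
  subDecSetoid = record
    { Carrier = Sub n
    ; _≈_ = _≈_
    ; isDecEquivalence = record
      { isEquivalence = record { refl = ≈-refl ; sym = ≈-sym ; trans = ≈-trans }
      ; _≟_ = _≈?_ } }

  reachB-≈ : ∀ {X Y : Sub n} → X ≈ Y → ∀ k v u → reachB X k v u ≡ reachB Y k v u
  reachB-≈ (vs≡ , es≡) zero    v u = cong (_∧ (v ==F u)) (vs≡ v)
  reachB-≈ (vs≡ , es≡) (suc k) v u = cong₂ _∨_ (reachB-≈ (vs≡ , es≡) k v u)
    (any-cong (allFin n) λ w → cong₂ _∧_ (reachB-≈ (vs≡ , es≡) k v w) (es≡ w u))

  reach-≈ : ∀ {X Y : Sub n} → X ≈ Y → ∀ v u → reach X v u ≡ reach Y v u
  reach-≈ X≈Y = reachB-≈ X≈Y n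

  deg-≈ : ∀ {X Y : Sub n} → X ≈ Y → ∀ u → deg X u ≡ deg Y u
  deg-≈ (_ , es≡) u = count-cong (es≡ u)

  IsSubgraph-≈ : ∀ {G : Graph n} {H K : Sub n} → H ≈ K → IsSubgraph G H → IsSubgraph G K
  IsSubgraph-≈ {H = H} {K} (vs≡ , es≡) s = record
    { es-sym = λ u v → trans (≡.sym (es≡ u v)) (trans (es-sym u v) (es≡ v u))
    ; es-adj = λ u v e → es-adj u v (trans (es≡ u v) e)
    ; es-vs  = λ u v e → trans (≡.sym (vs≡ u)) (es-vs u v (trans (es≡ u v) e)) }
    where open IsSubgraph s

  IsSachs-≈ : ∀ {G : Graph n} {p} {H K : Sub n} → H ≈ K → IsSachs G p H → IsSachs G p K
  IsSachs-≈ {H = H} {K} H≈K (subgraph , order≡ , comps) =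
    IsSubgraph-≈ H≈K subgraph , trans (count-cong λ v → ≡.sym (proj₁ H≈K v)) order≡ , comps′
    where
    comps′ : ∀ v → vs K v ≡ true → compIsK2 K v ⊎ compIsCycle K v
    comps′ v kv with comps v (trans (proj₁ H≈K v) kv)
    ... | inj₁ k2 = inj₁ (trans (count-cong λ u → ≡.sym (reach-≈ H≈K v u)) k2)
    ... | inj₂ cy = inj₂ λ u r → trans (≡.sym (deg-≈ H≈K u)) (cy u (trans (reach-≈ H≈K v u) r))

  isRep-≈ : ∀ {X Y : Sub n} → X ≈ Y → ∀ v → isRep X v ≡ isRep Y v
  isRep-≈ X≈Y v = isRep-cong (proj₁ X≈Y v) (reach-≈ X≈Y v)

  compIsCycleB-≈ : ∀ {X Y : Sub n} → X ≈ Y → ∀ v → compIsCycleB X v ≡ compIsCycleB Y v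
  compIsCycleB-≈ X≈Y v = compIsCycleB-cong (reach-≈ X≈Y v) (λ u _ → deg-≈ X≈Y u)

  weight-≈ : ∀ {X Y : Sub n} → X ≈ Y → weight X ≡ weight Y
  weight-≈ X≈Y = cong₂ (λ a b → (-1ℤ ^ a) * (+ (2 Nat.^ b)))
    (count-cong (isRep-≈ X≈Y)) (count-cong λ v → cong₂ _∧_ (isRep-≈ X≈Y v) (compIsCycleB-≈ X≈Y v))

-- Sums and cancellation in orbits of size three

∑ : ∀ {a} {A : Set a} → (A → ℤ) → List A → ℤ
∑ f xs = sumℤ (map f xs)

module _ {a} {A : Set a} where

  ∑-congᴬ : ∀ {f g : A → ℤ} {xs} → All (λ x → f x ≡ g x) xs → ∑ f xs ≡ ∑ g xs
  ∑-congᴬ []       = refl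
  ∑-congᴬ (e ∷ es) = cong₂ _+_ e (∑-congᴬ es)

  ∑-cong : ∀ {f g : A → ℤ} xs → (∀ x → f x ≡ g x) → ∑ f xs ≡ ∑ g xs
  ∑-cong xs h = ∑-congᴬ (All.universal h xs)

  ∑-zeroᴬ : ∀ {f : A → ℤ} {xs} → All (λ x → f x ≡ + 0) xs → ∑ f xs ≡ + 0
  ∑-zeroᴬ []       = refl
  ∑-zeroᴬ (e ∷ es) = cong₂ _+_ e (∑-zeroᴬ es)

  ∑-+ : ∀ (f g : A → ℤ) xs → ∑ (λ x → f x + g x) xs ≡ ∑ f xs + ∑ g xs
  ∑-+ f g []       = refl
  ∑-+ f g (x ∷ xs) = trans (cong (_+_ (f x + g x)) (∑-+ f g xs)) (interchange (f x) (g x) (∑ f xs) (∑ g xs))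

  ∑-*ʳ : ∀ (c : ℤ) (f : A → ℤ) xs → ∑ (λ x → f x * c) xs ≡ ∑ f xs * c
  ∑-*ʳ c f []       = refl
  ∑-*ʳ c f (x ∷ xs) = trans (cong (_+_ (f x * c)) (∑-*ʳ c f xs)) (≡.sym (ℤ.*-distribʳ-+ c (f x) (∑ f xs)))

∑-swap : ∀ {a b} {A : Set a} {B : Set b} (g : A → B → ℤ) xs ys →
  ∑ (λ x → ∑ (g x) ys) xs ≡ ∑ (λ y → ∑ (λ x → g x y) xs) ys
∑-swap g []       ys = ≡.sym (∑-zeroᴬ (All.universal (λ _ → refl) ys))
∑-swap g (x ∷ xs) ys = trans (cong (_+_ (∑ (g x) ys)) (∑-swap g xs ys))
                             (≡.sym (∑-+ (g x) (λ y → ∑ (λ x → g x y) xs) ys))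

-- Double counting: in ∑ₓ ∑ᵧ [y lies in the orbit {f₁ x, f₂ x, f₃ x}] w(y) every inner sum vanishes, while
-- each y lies in the orbits of exactly three x, namely f₁ y, f₂ y, f₃ y; so the double sum is also 3 ∑ᵧ w(y).
module TripleCancellation {c ℓ} (S : DecSetoid c ℓ) where
  open DecSetoid S using () renaming (_≟_ to _∼?_; Carrier to A; _≈_ to _∼_; sym to ∼-sym; trans to ∼-trans)

  δ : A → A → ℤ
  δ x y = if ⌊ x ∼? y ⌋ then + 1 else + 0

  δ-∼ : ∀ {x y} → x ∼ y → δ x y ≡ + 1
  δ-∼ {x} {y} x∼y with x ∼? y
  ... | yes _   = refl
  ... | no  x≁y = ⊥-elim (x≁y x∼y)

  δ-≁ : ∀ {x y} → ¬ x ∼ y → δ x y ≡ + 0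
  δ-≁ {x} {y} x≁y with x ∼? y
  ... | yes x∼y = ⊥-elim (x≁y x∼y)
  ... | no  _   = refl

  module _ (g : A → ℤ) (g-resp : ∀ {x y} → x ∼ y → g x ≡ g y) where

    ∑-δ-absent : ∀ x {L} → All (λ y → ¬ y ∼ x) L → ∑ (λ y → δ y x * g y) L ≡ + 0
    ∑-δ-absent x []          = refl
    ∑-δ-absent x (y≁x ∷ y≁s) = cong₂ _+_ (cong (_* g _) (δ-≁ y≁x)) (∑-δ-absent x y≁s)

    ∑-δ : ∀ x {L} → AllPairs (λ y z → ¬ y ∼ z) L → Any (x ∼_) L → ∑ (λ y → δ y x * g y) L ≡ g x
    ∑-δ x {y ∷ L} (y≁L ∷ _) (here x∼y) = begin
      δ y x * g y + ∑ (λ z → δ z x * g z) L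
        ≡⟨ cong₂ _+_ (cong (_* g y) (δ-∼ (∼-sym x∼y)))
                       (∑-δ-absent x (All.map (λ y≁z z∼x → y≁z (∼-trans (∼-sym x∼y) (∼-sym z∼x))) y≁L)) ⟩
      + 1 * g y + + 0      ≡⟨ trans (ℤ.+-identityʳ _) (ℤ.*-identityˡ (g y)) ⟩
      g y                  ≡⟨ g-resp (∼-sym x∼y) ⟩
      g x ∎
    ∑-δ x {y ∷ L} (y≁L ∷ L-distinct) (there x∈L) =
      trans (cong₂ _+_ (cong (_* g y) (δ-≁ (λ y∼x → y-absent y∼x y≁L x∈L))) (∑-δ x L-distinct x∈L))
            (ℤ.+-identityˡ (g x))
      where
      y-absent : ∀ {L} → y ∼ x → All (λ z → ¬ y ∼ z) L → Any (x ∼_) L → ⊥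
      y-absent y∼x (y≁z ∷ _)   (here x∼z)  = y≁z (∼-trans y∼x x∼z)
      y-absent y∼x (_ ∷ y≁L′)  (there x∈L′) = y-absent y∼x y≁L′ x∈L′

  module _ (P : A → Set) (w : A → ℤ) (w-resp : ∀ {x y} → x ∼ y → w x ≡ w y)
    (f₁ f₂ f₃ : A → A) (f₁-closed : ∀ {x} → P x → P (f₁ x)) (f₂-closed : ∀ {x} → P x → P (f₂ x))
    (f₃-closed : ∀ {x} → P x → P (f₃ x))
    (orbit-cancels : ∀ {x} → P x → w (f₁ x) + w (f₂ x) + w (f₃ x) ≡ + 0)
    (f₁≁f₂ : ∀ {x} → P x → ¬ f₁ x ∼ f₂ x) (f₁≁f₃ : ∀ {x} → P x → ¬ f₁ x ∼ f₃ x)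
    (f₂≁f₃ : ∀ {x} → P x → ¬ f₂ x ∼ f₃ x)
    where

    InOrbitOf : A → A → Set ℓ
    InOrbitOf y x = y ∼ f₁ x ⊎ y ∼ f₂ x ⊎ y ∼ f₃ x

    module _ (orbit-sym : ∀ {x y} → P x → P y → InOrbitOf y x → InOrbitOf x y)
      (L : List A) (L-sound : All P L) (L-complete : ∀ x → P x → Any (x ∼_) L)
      (L-distinct : AllPairs (λ x y → ¬ x ∼ y) L) where

      orbitCount : A → A → ℤ
      orbitCount y x = δ y (f₁ x) + δ y (f₂ x) + δ y (f₃ x)

      orbitCount-in : ∀ {x y} → P x → InOrbitOf y x → orbitCount y x ≡ + 1
      orbitCount-in px (inj₁ y∼f₁) rewrite δ-∼ y∼f₁
        | δ-≁ (λ y∼f₂ → f₁≁f₂ px (∼-trans (∼-sym y∼f₁) y∼f₂))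
        | δ-≁ (λ y∼f₃ → f₁≁f₃ px (∼-trans (∼-sym y∼f₁) y∼f₃)) = refl
      orbitCount-in px (inj₂ (inj₁ y∼f₂)) rewrite δ-∼ y∼f₂
        | δ-≁ (λ y∼f₁ → f₁≁f₂ px (∼-trans (∼-sym y∼f₁) y∼f₂))
        | δ-≁ (λ y∼f₃ → f₂≁f₃ px (∼-trans (∼-sym y∼f₂) y∼f₃)) = refl
      orbitCount-in px (inj₂ (inj₂ y∼f₃)) rewrite δ-∼ y∼f₃
        | δ-≁ (λ y∼f₁ → f₁≁f₃ px (∼-trans (∼-sym y∼f₁) y∼f₃))
        | δ-≁ (λ y∼f₂ → f₂≁f₃ px (∼-trans (∼-sym y∼f₂) y∼f₃)) = refl

      orbitCount-out : ∀ {x y} → ¬ InOrbitOf y x → orbitCount y x ≡ + 0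
      orbitCount-out y∉ rewrite δ-≁ (y∉ ∘ inj₁) | δ-≁ (y∉ ∘ inj₂ ∘ inj₁) | δ-≁ (y∉ ∘ inj₂ ∘ inj₂) =
        refl

      inOrbitOf? : ∀ y x → Dec (InOrbitOf y x)
      inOrbitOf? y x = y ∼? f₁ x ⊎-dec y ∼? f₂ x ⊎-dec y ∼? f₃ x

      orbitCount-sym : ∀ {x y} → P x → P y → orbitCount y x ≡ orbitCount x y
      orbitCount-sym {x} {y} px py with inOrbitOf? y x | inOrbitOf? x y
      ... | yes y∈ | _      = trans (orbitCount-in px y∈) (≡.sym (orbitCount-in py (orbit-sym px py y∈)))
      ... | no y∉  | yes x∈ = ⊥-elim (y∉ (orbit-sym py px x∈))
      ... | no y∉  | no x∉  = trans (orbitCount-out y∉) (≡.sym (orbitCount-out x∉))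

      ∑-orbitCount-weighted : ∀ {x} → P x → ∑ (λ y → orbitCount y x * w y) L ≡ + 0
      ∑-orbitCount-weighted {x} px = begin
        ∑ (λ y → orbitCount y x * w y) L
          ≡⟨ ∑-cong L (λ y → distrib (δ y (f₁ x)) (δ y (f₂ x)) (δ y (f₃ x)) (w y)) ⟩
        ∑ (λ y → δ y (f₁ x) * w y + δ y (f₂ x) * w y + δ y (f₃ x) * w y) L
          ≡⟨ trans (∑-+ _ _ L) (cong (_+ _) (∑-+ _ _ L)) ⟩
        ∑ (λ y → δ y (f₁ x) * w y) L + ∑ (λ y → δ y (f₂ x) * w y) L + ∑ (λ y → δ y (f₃ x) * w y) L
          ≡⟨ cong₂ _+_ (cong₂ _+_ (pick f₁-closed) (pick f₂-closed)) (pick f₃-closed) ⟩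
        w (f₁ x) + w (f₂ x) + w (f₃ x)
          ≡⟨ orbit-cancels px ⟩
        + 0 ∎
        where
        distrib : ∀ a b c d → (a + b + c) * d ≡ a * d + b * d + c * d
        distrib = solve-∀
        pick : ∀ {f : A → A} → (∀ {x} → P x → P (f x)) → ∑ (λ y → δ y (f x) * w y) L ≡ w (f x)
        pick {f} f-closed = ∑-δ w w-resp (f x) L-distinct (L-complete (f x) (f-closed px))

      ∑-orbitCount : ∀ {y} → P y → ∑ (orbitCount y) L ≡ + 3
      ∑-orbitCount {y} py = begin
        ∑ (orbitCount y) L
          ≡⟨ ∑-congᴬ (All.map (λ px → orbitCount-sym px py) L-sound) ⟩
        ∑ (λ x → δ x (f₁ y) + δ x (f₂ y) + δ x (f₃ y)) L
          ≡⟨ trans (∑-+ _ _ L) (cong (_+ _) (∑-+ _ _ L)) ⟩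
        ∑ (λ x → δ x (f₁ y)) L + ∑ (λ x → δ x (f₂ y)) L + ∑ (λ x → δ x (f₃ y)) L
          ≡⟨ cong₂ _+_ (cong₂ _+_ (one f₁-closed) (one f₂-closed)) (one f₃-closed) ⟩
        + 3 ∎
        where
        one : ∀ {f : A → A} → (∀ {x} → P x → P (f x)) → ∑ (λ x → δ x (f y)) L ≡ + 1
        one {f} f-closed = trans (∑-cong L λ x → ≡.sym (ℤ.*-identityʳ (δ x (f y))))
                                 (∑-δ (λ _ → + 1) (λ _ → refl) (f y) L-distinct (L-complete (f y) (f-closed py)))

      ∑-vanishes : ∑ w L ≡ + 0
      ∑-vanishes = ℤ.*-cancelˡ-≡ (+ 3) (∑ w L) (+ 0) (begin
        + 3 * ∑ w L                                   ≡⟨ ℤ.*-comm (+ 3) (∑ w L) ⟩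
        ∑ w L * + 3                                   ≡⟨ ≡.sym (∑-*ʳ (+ 3) w L) ⟩
        ∑ (λ y → w y * + 3) L                         ≡⟨ ∑-congᴬ (All.map (λ {y} py →
                                                             trans (ℤ.*-comm (w y) (+ 3))
                                                                   (cong (_* w y) (≡.sym (∑-orbitCount py)))) L-sound) ⟩
        ∑ (λ y → ∑ (orbitCount y) L * w y) L          ≡⟨ ≡.sym (∑-cong L λ y → ∑-*ʳ (w y) (orbitCount y) L) ⟩
        ∑ (λ y → ∑ (λ x → orbitCount y x * w y) L) L  ≡⟨ ≡.sym (∑-swap (λ x y → orbitCount y x * w y) L L) ⟩
        ∑ (λ x → ∑ (λ y → orbitCount y x * w y) L) L  ≡⟨ ∑-zeroᴬ (All.map ∑-orbitCount-weighted L-sound) ⟩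
        + 0 ∎)

-- The 4-cycle and its three Sachs shapes

-- The 4-cycle c₀ c₁ c₂ c₃ c₀; its edges form the two perfect matchings M₀₁ = {c₀c₁, c₂c₃} and
-- M₁₂ = {c₁c₂, c₃c₀}.
Corner : Set
Corner = Fin 4

pattern c₀ = Fin.zero
pattern c₁ = Fin.suc Fin.zero
pattern c₂ = Fin.suc (Fin.suc Fin.zero)
pattern c₃ = Fin.suc (Fin.suc (Fin.suc Fin.zero))

data Matching : Set where
  M₀₁ M₁₂ : Matching

_≟ᴹ_ : DecidableEquality Matching
M₀₁ ≟ᴹ M₀₁ = yes refl
M₁₂ ≟ᴹ M₁₂ = yes refl
M₀₁ ≟ᴹ M₁₂ = no λ ()
M₁₂ ≟ᴹ M₀₁ = no λ ()

matchingOf : Corner → Corner → Maybe Matching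
matchingOf c₀ c₁ = just M₀₁
matchingOf c₁ c₀ = just M₀₁
matchingOf c₂ c₃ = just M₀₁
matchingOf c₃ c₂ = just M₀₁
matchingOf c₁ c₂ = just M₁₂
matchingOf c₂ c₁ = just M₁₂
matchingOf c₃ c₀ = just M₁₂
matchingOf c₀ c₃ = just M₁₂
matchingOf _  _  = nothing

matchingOf-sym : ∀ x y → matchingOf x y ≡ matchingOf y x
matchingOf-sym = toWitness {a? = all? λ x → all? λ y → ≡-dec _≟ᴹ_ (matchingOf x y) (matchingOf y x)} _

matchingOf-irrefl : ∀ x → matchingOf x x ≡ nothing
matchingOf-irrefl = toWitness {a? = all? λ x → ≡-dec _≟ᴹ_ (matchingOf x x) nothing} _

partner : Matching → Corner → Corner
partner M₀₁ c₀ = c₁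
partner M₀₁ c₁ = c₀
partner M₀₁ c₂ = c₃
partner M₀₁ c₃ = c₂
partner M₁₂ c₀ = c₃
partner M₁₂ c₁ = c₂
partner M₁₂ c₂ = c₁
partner M₁₂ c₃ = c₀

matchingOf-partner : ∀ m x → matchingOf x (partner m x) ≡ just m
matchingOf-partner M₀₁ c₀ = refl
matchingOf-partner M₀₁ c₁ = refl
matchingOf-partner M₀₁ c₂ = refl
matchingOf-partner M₀₁ c₃ = refl
matchingOf-partner M₁₂ c₀ = refl
matchingOf-partner M₁₂ c₁ = refl
matchingOf-partner M₁₂ c₂ = refl
matchingOf-partner M₁₂ c₃ = refl

partner-unique : ∀ {m} x y → matchingOf x y ≡ just m → y ≡ partner m x
partner-unique c₀ c₁ refl = refl
partner-unique c₁ c₀ refl = refl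
partner-unique c₂ c₃ refl = refl
partner-unique c₃ c₂ refl = refl
partner-unique c₁ c₂ refl = refl
partner-unique c₂ c₁ refl = refl
partner-unique c₃ c₀ refl = refl
partner-unique c₀ c₃ refl = refl
partner-unique c₀ c₀ ()
partner-unique c₀ c₂ ()
partner-unique c₁ c₁ ()
partner-unique c₁ c₃ ()
partner-unique c₂ c₀ ()
partner-unique c₂ c₂ ()
partner-unique c₃ c₁ ()
partner-unique c₃ c₃ ()

partner-involutive : ∀ m x → partner m (partner m x) ≡ x
partner-involutive m x =
  ≡.sym (partner-unique (partner m x) x (trans (matchingOf-sym _ x) (matchingOf-partner m x)))

partner-≢ : ∀ m x → x ≢ partner m x
partner-≢ m x x≡p =
  case trans (≡.sym (matchingOf-irrefl x)) (trans (cong (matchingOf x) x≡p) (matchingOf-partner m x)) of λ ()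

partners-≢ : ∀ x → partner M₀₁ x ≢ partner M₁₂ x
partners-≢ x p≡p′ =
  case trans (≡.sym (matchingOf-partner M₀₁ x)) (trans (cong (matchingOf x) p≡p′) (matchingOf-partner M₁₂ x)) of λ ()

matched : Matching → Corner → Corner → Bool
matched m x y = ⌊ y ≟ x ⌋ ∨ ⌊ y ≟ partner m x ⌋

⌊≟⌋⇒≡ : ∀ {x y : Corner} → ⌊ x ≟ y ⌋ ≡ true → x ≡ y
⌊≟⌋⇒≡ {x} {y} e with x ≟ y
... | yes x≡y = x≡y

⌊≟⌋-refl : ∀ (x : Corner) → ⌊ x ≟ x ⌋ ≡ true
⌊≟⌋-refl x with x ≟ x
... | yes _   = refl
... | no  x≢x = ⊥-elim (x≢x refl)

matched-elim : ∀ m x y → matched m x y ≡ true → y ≡ x ⊎ y ≡ partner m x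
matched-elim m x y e with ∨-true e
... | inj₁ y≡x = inj₁ (⌊≟⌋⇒≡ y≡x)
... | inj₂ y≡p = inj₂ (⌊≟⌋⇒≡ y≡p)

matched-self : ∀ m x → matched m x x ≡ true
matched-self m x = ∨-trueˡ (⌊≟⌋-refl x)

matched-partner : ∀ m x → matched m x (partner m x) ≡ true
matched-partner m x = ∨-trueʳ {⌊ partner m x ≟ x ⌋} (⌊≟⌋-refl (partner m x))

matched-same : ∀ m x y → matched m x y ≡ true → ∀ z → matched m y z ≡ matched m x z
matched-same m x y e z with matched-elim m x y e
... | inj₁ refl = refl
... | inj₂ refl rewrite partner-involutive m x = ∨-comm ⌊ z ≟ partner m x ⌋ ⌊ z ≟ x ⌋

matched-partner-closed : ∀ m x y → matched m x y ≡ true → matched m x (partner m y) ≡ true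
matched-partner-closed m x y e with matched-elim m x y e
... | inj₁ refl = matched-partner m x
... | inj₂ refl rewrite partner-involutive m x = matched-self m x

-- A corner on the edge of m that avoids c₀.
otherEdge : Matching → Corner
otherEdge M₀₁ = c₂
otherEdge M₁₂ = c₁

matched-otherEdge : ∀ m y → matched m (otherEdge m) y ≡ not (matched m c₀ y)
matched-otherEdge M₀₁ c₀ = refl
matched-otherEdge M₀₁ c₁ = refl
matched-otherEdge M₀₁ c₂ = refl
matched-otherEdge M₀₁ c₃ = refl
matched-otherEdge M₁₂ c₀ = refl
matched-otherEdge M₁₂ c₁ = refl
matched-otherEdge M₁₂ c₂ = refl
matched-otherEdge M₁₂ c₃ = refl

data Shape : Set where
  perfect : Matching → Shape
  cycle   : Shape

shapeHas : Shape → Maybe Matching → Bool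
shapeHas _           nothing   = false
shapeHas (perfect m) (just m′) = ⌊ m ≟ᴹ m′ ⌋
shapeHas cycle       (just _)  = true

shapeEdge : Shape → Corner → Corner → Bool
shapeEdge s x y = shapeHas s (matchingOf x y)

cycleEdge : Corner → Corner → Bool
cycleEdge = shapeEdge cycle

shapeEdge-sym : ∀ s x y → shapeEdge s x y ≡ shapeEdge s y x
shapeEdge-sym s x y = cong (shapeHas s) (matchingOf-sym x y)

shapeEdge⇒cycleEdge : ∀ s x y → shapeEdge s x y ≡ true → cycleEdge x y ≡ true
shapeEdge⇒cycleEdge s x y with matchingOf x y
... | just _  = λ _ → refl
... | nothing = λ ()

cycleEdge-irrefl : ∀ x → cycleEdge x x ≡ false
cycleEdge-irrefl x = cong (shapeHas cycle) (matchingOf-irrefl x)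

cycleEdge-partner : ∀ m x → cycleEdge x (partner m x) ≡ true
cycleEdge-partner m x = cong (shapeHas cycle) (matchingOf-partner m x)

perfect-partner : ∀ m x → shapeEdge (perfect m) x (partner m x) ≡ true
perfect-partner m x rewrite matchingOf-partner m x with m ≟ᴹ m
... | yes _  = refl
... | no m≢m = ⊥-elim (m≢m refl)

perfect-unique : ∀ m x y → shapeEdge (perfect m) x y ≡ true → y ≡ partner m x
perfect-unique m x y e with matchingOf x y in xy
... | just m′ with m ≟ᴹ m′
...   | yes refl = partner-unique x y xy

cycle-neighbours : ∀ x y → cycleEdge x y ≡ true → y ≡ partner M₀₁ x ⊎ y ≡ partner M₁₂ x
cycle-neighbours x y e with matchingOf x y in xy
... | just M₀₁ = inj₁ (partner-unique x y xy)
... | just M₁₂ = inj₂ (partner-unique x y xy)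

data Distance≤2 (x y : Corner) : Set where
  same      : x ≡ y → Distance≤2 x y
  adjacent  : cycleEdge x y ≡ true → Distance≤2 x y
  opposite  : ∀ z → cycleEdge x z ≡ true → cycleEdge z y ≡ true → Distance≤2 x y

distance≤2 : ∀ x y → Distance≤2 x y
distance≤2 c₀ c₀ = same refl
distance≤2 c₀ c₁ = adjacent refl
distance≤2 c₀ c₂ = opposite c₁ refl refl
distance≤2 c₀ c₃ = adjacent refl
distance≤2 c₁ c₀ = adjacent refl
distance≤2 c₁ c₁ = same refl
distance≤2 c₁ c₂ = adjacent refl
distance≤2 c₁ c₃ = opposite c₂ refl refl
distance≤2 c₂ c₀ = opposite c₁ refl refl
distance≤2 c₂ c₁ = adjacent refl
distance≤2 c₂ c₂ = same refl
distance≤2 c₂ c₃ = adjacent refl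
distance≤2 c₃ c₀ = adjacent refl
distance≤2 c₃ c₁ = opposite c₀ refl refl
distance≤2 c₃ c₂ = adjacent refl
distance≤2 c₃ c₃ = same refl

shapeFrom : Bool → Bool → Shape
shapeFrom true  true  = cycle
shapeFrom true  false = perfect M₀₁
shapeFrom false _     = perfect M₁₂

byMatching : Bool → Bool → Matching → Bool
byMatching b₀₁ _   M₀₁ = b₀₁
byMatching _   b₁₂ M₁₂ = b₁₂

shapeFrom-has : ∀ b₀₁ b₁₂ → b₀₁ ∨ b₁₂ ≡ true → ∀ m →
  shapeHas (shapeFrom b₀₁ b₁₂) (just m) ≡ byMatching b₀₁ b₁₂ m
shapeFrom-has true  true  _ M₀₁ = refl
shapeFrom-has true  true  _ M₁₂ = refl
shapeFrom-has true  false _ M₀₁ = refl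
shapeFrom-has true  false _ M₁₂ = refl
shapeFrom-has false true  _ M₀₁ = refl
shapeFrom-has false true  _ M₁₂ = refl

shapeFrom-shapeEdge : ∀ s → shapeFrom (shapeEdge s c₀ c₁) (shapeEdge s c₁ c₂) ≡ s
shapeFrom-shapeEdge (perfect M₀₁) = refl
shapeFrom-shapeEdge (perfect M₁₂) = refl
shapeFrom-shapeEdge cycle         = refl

-- The hypotheses on e say that each component of e is a K₂ or a cycle.
module Classification (e : Corner → Corner → Bool) (e-sym : ∀ x y → e x y ≡ e y x)
  (e⊆cycle : ∀ x y → e x y ≡ true → cycleEdge x y ≡ true)
  (e-covers : ∀ x → ∃ λ y → e x y ≡ true)
  (e-no-pendant-walk : ∀ x y z → (∀ y′ → e x y′ ≡ true → y′ ≡ y) →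
                       e x y ≡ true → e y z ≡ true → z ≢ x → ⊥)
  where

  private
    e-neighbours : ∀ x y → e x y ≡ true → y ≡ partner M₀₁ x ⊎ y ≡ partner M₁₂ x
    e-neighbours x y h = cycle-neighbours x y (e⊆cycle x y h)

    uncovered : ∀ x → e x (partner M₀₁ x) ≡ false → e x (partner M₁₂ x) ≡ false → ⊥
    uncovered x ¬e₀₁ ¬e₁₂ with e-covers x
    ... | y , h with e-neighbours x y h
    ...   | inj₁ refl = true≢false h ¬e₀₁
    ...   | inj₂ refl = true≢false h ¬e₁₂

    only-M₀₁ : ∀ x → e x (partner M₁₂ x) ≡ false → ∀ y → e x y ≡ true → y ≡ partner M₀₁ x
    only-M₀₁ x ¬e y h with e-neighbours x y h
    ... | inj₁ y≡ = y≡
    ... | inj₂ refl = ⊥-elim (true≢false h ¬e)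

    only-M₁₂ : ∀ x → e x (partner M₀₁ x) ≡ false → ∀ y → e x y ≡ true → y ≡ partner M₁₂ x
    only-M₁₂ x ¬e y h with e-neighbours x y h
    ... | inj₁ refl = ⊥-elim (true≢false h ¬e)
    ... | inj₂ y≡ = y≡

    sym-val : ∀ {x y b} → e y x ≡ b → e x y ≡ b
    sym-val {x} {y} h = trans (e-sym x y) h

  opposite-edges-agree : e c₀ c₁ ≡ e c₂ c₃ × e c₁ c₂ ≡ e c₃ c₀ × e c₀ c₁ ∨ e c₁ c₂ ≡ true
  opposite-edges-agree with e c₀ c₁ in e₀₁ | e c₁ c₂ in e₁₂ | e c₂ c₃ in e₂₃ | e c₃ c₀ in e₃₀
  ... | true  | true  | true  | true  = refl , refl , refl
  ... | true  | false | true  | false = refl , refl , refl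
  ... | false | true  | false | true  = refl , refl , refl
  ... | true  | true  | true  | false = ⊥-elim (e-no-pendant-walk c₀ c₁ c₂ (only-M₀₁ c₀ (sym-val e₃₀)) e₀₁ e₁₂ λ ())
  ... | true  | true  | false | true  = ⊥-elim (e-no-pendant-walk c₂ c₁ c₀ (only-M₁₂ c₂ e₂₃) (sym-val e₁₂) (sym-val e₀₁) λ ())
  ... | true  | false | true  | true  = ⊥-elim (e-no-pendant-walk c₁ c₀ c₃ (only-M₀₁ c₁ e₁₂) (sym-val e₀₁) (sym-val e₃₀) λ ())
  ... | false | true  | true  | true  = ⊥-elim (e-no-pendant-walk c₀ c₃ c₂ (only-M₁₂ c₀ e₀₁) (sym-val e₃₀) (sym-val e₂₃) λ ())
  ... | true  | true  | false | false = ⊥-elim (uncovered c₃ (sym-val e₂₃) e₃₀)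
  ... | false | true  | true  | false = ⊥-elim (uncovered c₀ e₀₁ (sym-val e₃₀))
  ... | false | false | true  | true  = ⊥-elim (uncovered c₁ (sym-val e₀₁) e₁₂)
  ... | true  | false | false | true  = ⊥-elim (uncovered c₂ e₂₃ (sym-val e₁₂))
  ... | true  | false | false | false = ⊥-elim (uncovered c₂ e₂₃ (sym-val e₁₂))
  ... | false | true  | false | false = ⊥-elim (uncovered c₃ (sym-val e₂₃) e₃₀)
  ... | false | false | true  | false = ⊥-elim (uncovered c₀ e₀₁ (sym-val e₃₀))
  ... | false | false | false | true  = ⊥-elim (uncovered c₁ (sym-val e₀₁) e₁₂)
  ... | false | false | false | false = ⊥-elim (uncovered c₀ e₀₁ (sym-val e₃₀))

  shape : Shape
  shape = shapeFrom (e c₀ c₁) (e c₁ c₂)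

  private
    e₀₁≡e₂₃ : e c₀ c₁ ≡ e c₂ c₃
    e₀₁≡e₂₃ = proj₁ opposite-edges-agree
    e₁₂≡e₃₀ : e c₁ c₂ ≡ e c₃ c₀
    e₁₂≡e₃₀ = proj₁ (proj₂ opposite-edges-agree)

    e-on-matching : ∀ m x → e x (partner m x) ≡ byMatching (e c₀ c₁) (e c₁ c₂) m
    e-on-matching M₀₁ c₀ = refl
    e-on-matching M₀₁ c₁ = e-sym c₁ c₀
    e-on-matching M₀₁ c₂ = ≡.sym e₀₁≡e₂₃
    e-on-matching M₀₁ c₃ = trans (e-sym c₃ c₂) (≡.sym e₀₁≡e₂₃)
    e-on-matching M₁₂ c₀ = trans (e-sym c₀ c₃) (≡.sym e₁₂≡e₃₀)
    e-on-matching M₁₂ c₁ = refl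
    e-on-matching M₁₂ c₂ = e-sym c₂ c₁
    e-on-matching M₁₂ c₃ = ≡.sym e₁₂≡e₃₀

  e≡shapeEdge : ∀ x y → e x y ≡ shapeEdge shape x y
  e≡shapeEdge x y with matchingOf x y in xy
  ... | nothing = ≢true⇒≡false λ h → true≢false (e⊆cycle x y h) (cong (shapeHas cycle) xy)
  ... | just m rewrite partner-unique x y xy =
    trans (e-on-matching m x) (≡.sym (shapeFrom-has (e c₀ c₁) (e c₁ c₂) (proj₂ (proj₂ opposite-edges-agree)) m))

-- Reshaping a subgraph at the corners of C

liftMaybe : (Corner → Corner → Bool) → Maybe Corner → Maybe Corner → Bool
liftMaybe R (just x) (just y) = R x y
liftMaybe R _        _        = false

module Corners {n : ℕ} (ι : Corner → Fin n) (ι-injective : ∀ {x y} → ι x ≡ ι y → x ≡ y) where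

  cornerAt : Fin n → Maybe Corner
  cornerAt u = if u ==F ι c₀ then just c₀ else if u ==F ι c₁ then just c₁ else
               if u ==F ι c₂ then just c₂ else if u ==F ι c₃ then just c₃ else nothing

  onC : Fin n → Bool
  onC u = is-just (cornerAt u)

  liftC : (Corner → Corner → Bool) → Fin n → Fin n → Bool
  liftC R u v = liftMaybe R (cornerAt u) (cornerAt v)

  liftP : (Corner → Bool) → Fin n → Bool
  liftP p u = maybe′ p false (cornerAt u)

  private
    ι-≢ : ∀ {x y} → x ≢ y → (ι x ==F ι y) ≡ false
    ι-≢ x≢y = ≢⇒==F-false (x≢y ∘ ι-injective)

  cornerAt-ι : ∀ x → cornerAt (ι x) ≡ just x
  cornerAt-ι c₀ rewrite ==F-refl (ι c₀) = refl
  cornerAt-ι c₁ rewrite ι-≢ {c₁} {c₀} (λ ()) | ==F-refl (ι c₁) = refl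
  cornerAt-ι c₂ rewrite ι-≢ {c₂} {c₀} (λ ()) | ι-≢ {c₂} {c₁} (λ ()) | ==F-refl (ι c₂) = refl
  cornerAt-ι c₃ rewrite ι-≢ {c₃} {c₀} (λ ()) | ι-≢ {c₃} {c₁} (λ ()) | ι-≢ {c₃} {c₂} (λ ())
                      | ==F-refl (ι c₃) = refl

  data CornerView (u : Fin n) : Set where
    corner  : ∀ x → u ≡ ι x → CornerView u
    outside : cornerAt u ≡ nothing → CornerView u

  cornerView : ∀ u → CornerView u
  cornerView u with u ==F ι c₀ in e₀
  ... | true = corner c₀ (==F⇒≡ e₀)
  ... | false with u ==F ι c₁ in e₁
  ...   | true = corner c₁ (==F⇒≡ e₁)
  ...   | false with u ==F ι c₂ in e₂
  ...     | true = corner c₂ (==F⇒≡ e₂)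
  ...     | false with u ==F ι c₃ in e₃
  ...       | true  = corner c₃ (==F⇒≡ e₃)
  ...       | false = outside (none e₀ e₁ e₂ e₃)
    where
    none : (u ==F ι c₀) ≡ false → (u ==F ι c₁) ≡ false → (u ==F ι c₂) ≡ false → (u ==F ι c₃) ≡ false →
      cornerAt u ≡ nothing
    none f₀ f₁ f₂ f₃ rewrite f₀ | f₁ | f₂ | f₃ = refl

  onC-ι : ∀ x → onC (ι x) ≡ true
  onC-ι x rewrite cornerAt-ι x = refl

  liftC-ι : ∀ R x y → liftC R (ι x) (ι y) ≡ R x y
  liftC-ι R x y rewrite cornerAt-ι x | cornerAt-ι y = refl

  liftP-ι : ∀ p x → liftP p (ι x) ≡ p x
  liftP-ι p x rewrite cornerAt-ι x = refl

  onC-outside : ∀ u → cornerAt u ≡ nothing → onC u ≡ false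
  onC-outside u e = cong is-just e

  liftP-outside : ∀ p u → cornerAt u ≡ nothing → liftP p u ≡ false
  liftP-outside p u e = cong (maybe′ p false) e

  liftC-outsideˡ : ∀ R u v → cornerAt u ≡ nothing → liftC R u v ≡ false
  liftC-outsideˡ R u v e = cong (λ z → liftMaybe R z (cornerAt v)) e

  liftC-outsideʳ : ∀ R u v → cornerAt v ≡ nothing → liftC R u v ≡ false
  liftC-outsideʳ R u v e rewrite e with cornerAt u
  ... | just _  = refl
  ... | nothing = refl

  outside-onC : ∀ u → onC u ≡ false → cornerAt u ≡ nothing
  outside-onC u e with cornerAt u
  ... | nothing = refl

  liftC-offˡ : ∀ R u v → onC u ≡ false → liftC R u v ≡ false
  liftC-offˡ R u v e = liftC-outsideˡ R u v (outside-onC u e)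

  liftC⇒onCˡ : ∀ R u v → liftC R u v ≡ true → onC u ≡ true
  liftC⇒onCˡ R u v e with cornerView u
  ... | corner x refl = onC-ι x
  ... | outside out   = ⊥-elim (true≢false e (liftC-outsideˡ R u v out))

  liftC⇒onCʳ : ∀ R u v → liftC R u v ≡ true → onC v ≡ true
  liftC⇒onCʳ R u v e with cornerView v
  ... | corner y refl = onC-ι y
  ... | outside out   = ⊥-elim (true≢false e (liftC-outsideʳ R u v out))

  liftC-sym : ∀ {R} → (∀ x y → R x y ≡ R y x) → ∀ u v → liftC R u v ≡ liftC R v u
  liftC-sym {R} R-sym u v with cornerView u | cornerView v
  ... | corner x refl | corner y refl = trans (liftC-ι R x y) (trans (R-sym x y) (≡.sym (liftC-ι R y x)))
  ... | corner x refl | outside out   = trans (liftC-outsideʳ R (ι x) v out) (≡.sym (liftC-outsideˡ R v (ι x) out))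
  ... | outside out   | _             = trans (liftC-outsideˡ R u v out) (≡.sym (liftC-outsideʳ R v u out))

  liftC-mono : ∀ {R R′} → (∀ x y → R x y ≡ true → R′ x y ≡ true) →
    ∀ u v → liftC R u v ≡ true → liftC R′ u v ≡ true
  liftC-mono {R} {R′} R⊆R′ u v e with cornerView u | cornerView v
  ... | corner x refl | corner y refl = trans (liftC-ι R′ x y) (R⊆R′ x y (trans (≡.sym (liftC-ι R x y)) e))
  ... | corner x refl | outside out   = ⊥-elim (true≢false e (liftC-outsideʳ R (ι x) v out))
  ... | outside out   | _             = ⊥-elim (true≢false e (liftC-outsideˡ R u v out))

  liftC-at-ι : ∀ R x v → liftC R (ι x) v ≡ true → ∃ λ y → v ≡ ι y × R x y ≡ true
  liftC-at-ι R x v e with cornerView v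
  ... | corner y refl = y , refl , trans (≡.sym (liftC-ι R x y)) e
  ... | outside out   = ⊥-elim (true≢false e (liftC-outsideʳ R (ι x) v out))

  liftP⇒onC : ∀ p u → liftP p u ≡ true → onC u ≡ true
  liftP⇒onC p u e with cornerView u
  ... | corner x refl = onC-ι x
  ... | outside out   = ⊥-elim (true≢false e (liftP-outside p u out))

  liftP-cong : ∀ {p q} → (∀ x → p x ≡ q x) → ∀ u → liftP p u ≡ liftP q u
  liftP-cong p≗q u with cornerAt u
  ... | just x  = p≗q x
  ... | nothing = refl

  ==F-ι : ∀ x y → (ι x ==F ι y) ≡ ⌊ x ≟ y ⌋
  ==F-ι x y with x ≟ y
  ... | yes refl = ==F-refl (ι x)
  ... | no  x≢y  = ι-≢ x≢y

  count-liftP-pair : ∀ {x x′} → x ≢ x′ → count (liftP λ y → ⌊ y ≟ x ⌋ ∨ ⌊ y ≟ x′ ⌋) ≡ 2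
  count-liftP-pair {x} {x′} x≢x′ = trans (count-cong as-list) (count-∈ᵇ ((ι-≢′ ∷ []) ∷ [] ∷ []))
    where
    ι-≢′ : ι x ≢ ι x′
    ι-≢′ = x≢x′ ∘ ι-injective
    as-list : ∀ u → liftP (λ y → ⌊ y ≟ x ⌋ ∨ ⌊ y ≟ x′ ⌋) u ≡ u ∈ᵇ (ι x ∷ ι x′ ∷ [])
    as-list u with cornerView u
    ... | corner y refl = trans (liftP-ι _ y)
                            (≡.sym (cong₂ _∨_ (==F-ι y x) (trans (∨-identityʳ _) (==F-ι y x′))))
    ... | outside out   =
      trans (liftP-outside _ u out) (≡.sym (cong₂ _∨_ (not-at x) (trans (∨-identityʳ _) (not-at x′))))
      where
      not-at : ∀ z → (u ==F ι z) ≡ false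
      not-at z = ≢⇒==F-false {u = u} {ι z} λ { refl → case trans (≡.sym (cornerAt-ι z)) out of λ () }

Fin-≢⇒2≤ : ∀ {n} {x y : Fin n} → x ≢ y → 2 ≤ n
Fin-≢⇒2≤ {suc zero}    {Fin.zero} {Fin.zero} x≢y = ⊥-elim (x≢y refl)
Fin-≢⇒2≤ {suc (suc n)} _                         = s≤s (s≤s z≤n)

module OnCycle {n : ℕ} (G : Graph n) (C : Sub n) (C⊆G : IsSubgraph G C)
  (ι : Corner → Fin n) (ι-injective : ∀ {x y} → ι x ≡ ι y → x ≡ y)
  (vs-C : ∀ u → vs C u ≡ Corners.onC ι ι-injective u)
  (es-C : ∀ u v → es C u v ≡ Corners.liftC ι ι-injective cycleEdge u v)
  (deg-C : ∀ u → vs C u ≡ true → deg C u ≡ 2) (order-C : order C ≡ 4)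
  where
  open Corners ι ι-injective

  2≤n : 2 ≤ n
  2≤n = Fin-≢⇒2≤ {x = ι c₀} {ι c₁} λ e → case ι-injective e of λ ()

  offC : Fin n → Bool
  offC u = not (onC u)

  reshape : Shape → Sub n → Sub n
  reshape s X = sub (vs X) (λ u v → if onC u ∨ onC v then liftC (shapeEdge s) u v else es X u v)

  bare : Sub n
  bare = sub onC (λ _ _ → false)

  shapeGraph : Shape → Sub n
  shapeGraph s = reshape s bare

  record Compatible (X : Sub n) : Set where
    field
      subgraph    : IsSubgraph G X
      onC⊆vs      : ∀ u → onC u ≡ true → vs X u ≡ true
      no-crossing : ∀ u v → onC u ≡ false → onC v ≡ true → es X u v ≡ false
      sachs-off   : ∀ v → vs X v ≡ true → onC v ≡ false → compIsK2 X v ⊎ compIsCycle X v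

  bare-compatible : Compatible bare
  bare-compatible = record
    { subgraph    = record { es-sym = λ _ _ → refl ; es-adj = λ _ _ () ; es-vs = λ _ _ () }
    ; onC⊆vs      = λ _ e → e
    ; no-crossing = λ _ _ _ _ → refl
    ; sachs-off   = λ v on off → ⊥-elim (true≢false on off) }

  es-reshape-on : ∀ s X u w → onC u ≡ true → es (reshape s X) u w ≡ liftC (shapeEdge s) u w
  es-reshape-on s X u w e rewrite e = refl

  es-shapeGraph-ι : ∀ s x y → es (shapeGraph s) (ι x) (ι y) ≡ shapeEdge s x y
  es-shapeGraph-ι s x y = trans (es-reshape-on s bare (ι x) (ι y) (onC-ι x)) (liftC-ι (shapeEdge s) x y)

  shapeGraph-neighbour : ∀ s x w → es (shapeGraph s) (ι x) w ≡ true → ∃ λ y → w ≡ ι y × shapeEdge s x y ≡ true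
  shapeGraph-neighbour s x w h =
    liftC-at-ι (shapeEdge s) x w (trans (≡.sym (es-reshape-on s bare (ι x) w (onC-ι x))) h)

  onC-closed : ∀ s X u w → onC u ≡ true → es (reshape s X) u w ≡ true → onC w ≡ true
  onC-closed s X u w e h = liftC⇒onCʳ (shapeEdge s) u w (trans (≡.sym (es-reshape-on s X u w e)) h)

  deg-reshape-on : ∀ s X u → onC u ≡ true → deg (reshape s X) u ≡ count (liftC (shapeEdge s) u)
  deg-reshape-on s X u e = count-cong λ w → es-reshape-on s X u w e

  module _ {X : Sub n} (compat : Compatible X) where
    open Compatible compat

    es-reshape-off : ∀ s u w → onC u ≡ false → es (reshape s X) u w ≡ es X u w
    es-reshape-off s u w e rewrite e with onC w in ew
    ... | true  = trans (liftC-offˡ (shapeEdge s) u w e) (≡.sym (no-crossing u w e ew))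
    ... | false = refl

    offC-closed : ∀ u w → offC u ≡ true → es X u w ≡ true → offC w ≡ true
    offC-closed u w off h with onC w in ew
    ... | true  = ⊥-elim (true≢false h (no-crossing u w (not-injective off) ew))
    ... | false = refl

    reach-reshape-off : ∀ s v u → onC v ≡ false → reach (reshape s X) v u ≡ reach X v u
    reach-reshape-off s v u e = reach-local (reshape s X) X offC offC-closed (λ _ _ → refl)
      (λ u w off → es-reshape-off s u w (not-injective off)) u (cong not e)

    reach-reshape-on : ∀ s v u → onC v ≡ true → reach (reshape s X) v u ≡ reach (shapeGraph s) v u
    reach-reshape-on s v u e = reach-local (reshape s X) (shapeGraph s) onC (onC-closed s bare)
      (λ u on → trans (onC⊆vs u on) (≡.sym on))
      (λ u w on → trans (es-reshape-on s X u w on) (≡.sym (es-reshape-on s bare u w on))) u e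

    deg-reshape-off : ∀ s u → onC u ≡ false → deg (reshape s X) u ≡ deg X u
    deg-reshape-off s u e = count-cong λ w → es-reshape-off s u w e

  reach-perfect : ∀ m x u → reach (shapeGraph (perfect m)) (ι x) u ≡ liftP (matched m x) u
  reach-perfect m x u =
    true⇔true⇒≡ (reach-closed K (liftP (matched m x)) closed (trans (liftP-ι _ x) (matched-self m x))) back
    where
    K : Sub n
    K = shapeGraph (perfect m)
    closed : ∀ u w → liftP (matched m x) u ≡ true → es K u w ≡ true → liftP (matched m x) w ≡ true
    closed u w su h with cornerView u
    ... | outside out   = ⊥-elim (true≢false su (liftP-outside _ u out))
    ... | corner y refl with shapeGraph-neighbour (perfect m) y w h
    ...   | z , refl , yz rewrite liftP-ι (matched m x) z | perfect-unique m y z yz =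
      matched-partner-closed m x y (trans (≡.sym (liftP-ι _ y)) su)
    back : liftP (matched m x) u ≡ true → reach K (ι x) u ≡ true
    back su with cornerView u
    ... | outside out   = ⊥-elim (true≢false su (liftP-outside _ u out))
    ... | corner y refl with matched-elim m x y (trans (≡.sym (liftP-ι _ y)) su)
    ...   | inj₁ refl = reach-refl K (onC-ι x)
    ...   | inj₂ refl = reach-edge K (onC-ι x) (trans (es-shapeGraph-ι (perfect m) x (partner m x)) (perfect-partner m x))

  reach-cycle : ∀ x u → reach (shapeGraph cycle) (ι x) u ≡ onC u
  reach-cycle x u = true⇔true⇒≡ (reach-closed K onC (onC-closed cycle bare) (onC-ι x)) back
    where
    K : Sub n
    K = shapeGraph cycle
    back : onC u ≡ true → reach K (ι x) u ≡ true
    back on with cornerView u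
    ... | outside out   = ⊥-elim (true≢false on (onC-outside u out))
    ... | corner y refl with distance≤2 x y
    ...   | same refl        = reach-refl K (onC-ι x)
    ...   | adjacent xy      = reach-edge K (onC-ι x) (trans (es-shapeGraph-ι cycle x y) xy)
    ...   | opposite z xz zy = reach-path₂ K 2≤n {ι x} {ι z} (onC-ι x) (trans (es-shapeGraph-ι cycle x z) xz)
                                                           (trans (es-shapeGraph-ι cycle z y) zy)

  matchedComponent : ∀ m x → Component (shapeGraph (perfect m)) (liftP (matched m x))
  matchedComponent m x = record
    { ⊆vs          = liftP⇒onC (matched m x)
    ; reach-within = within
    ; inhabitant   = ι x
    ; inhabited    = trans (liftP-ι _ x) (matched-self m x) }
    where
    within : ∀ {v} u → liftP (matched m x) v ≡ true → reach (shapeGraph (perfect m)) v u ≡ liftP (matched m x) u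
    within {v} u sv with cornerView v
    ... | outside out   = ⊥-elim (true≢false sv (liftP-outside _ v out))
    ... | corner y refl =
      trans (reach-perfect m y u) (liftP-cong (matched-same m x y (trans (≡.sym (liftP-ι _ y)) sv)) u)

  cycleComponent : Component (shapeGraph cycle) onC
  cycleComponent = record
    { ⊆vs          = λ _ on → on
    ; reach-within = within
    ; inhabitant   = ι c₀
    ; inhabited    = onC-ι c₀ }
    where
    within : ∀ {v} u → onC v ≡ true → reach (shapeGraph cycle) v u ≡ onC u
    within {v} u on with cornerView v
    ... | outside out   = ⊥-elim (true≢false on (onC-outside v out))
    ... | corner x refl = reach-cycle x u

  count-matched : ∀ m x → count (liftP (matched m x)) ≡ 2
  count-matched m x = count-liftP-pair (partner-≢ m x)

  deg-cycle : ∀ u → onC u ≡ true → count (liftC cycleEdge u) ≡ 2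
  deg-cycle u on = trans (count-cong λ w → ≡.sym (es-C u w)) (deg-C u (trans (vs-C u) on))

  reshape-components-on : ∀ s {X} → Compatible X → ∀ v → onC v ≡ true →
    compIsK2 (reshape s X) v ⊎ compIsCycle (reshape s X) v
  reshape-components-on s compat v on with cornerView v
  ... | outside out = ⊥-elim (true≢false on (onC-outside v out))
  reshape-components-on (perfect m) compat v on | corner x refl =
    inj₁ (trans (count-cong λ u → trans (reach-reshape-on compat (perfect m) (ι x) u on) (reach-perfect m x u))
                (count-matched m x))
  reshape-components-on cycle {X} compat v on | corner x refl = inj₂ λ u r →
    let on-u = reach-closed (reshape cycle X) onC (onC-closed cycle X) on r
    in trans (deg-reshape-on cycle X u on-u) (deg-cycle u on-u)

  reshape-IsSachs : ∀ s {X} → Compatible X → IsSachs G (order X) (reshape s X)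
  reshape-IsSachs s {X} compat = subgraph′ , refl , components
    where
    open Compatible compat
    open IsSubgraph subgraph
    subgraph′ : IsSubgraph G (reshape s X)
    subgraph′ = record { es-sym = sym′ ; es-adj = adj′ ; es-vs = vs′ }
      where
      sym′ : ∀ u v → es (reshape s X) u v ≡ es (reshape s X) v u
      sym′ u v rewrite ∨-comm (onC u) (onC v) | liftC-sym (shapeEdge-sym s) u v | es-sym u v = refl
      adj′ : ∀ u v → es (reshape s X) u v ≡ true → adj G u v ≡ true
      adj′ u v h with onC u ∨ onC v
      ... | true  = IsSubgraph.es-adj C⊆G u v (trans (es-C u v) (liftC-mono (shapeEdge⇒cycleEdge s) u v h))
      ... | false = es-adj u v h
      vs′ : ∀ u v → es (reshape s X) u v ≡ true → vs X u ≡ true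
      vs′ u v h with onC u ∨ onC v
      ... | true  = onC⊆vs u (liftC⇒onCˡ (shapeEdge s) u v h)
      ... | false = es-vs u v h
    components : ∀ v → vs X v ≡ true → compIsK2 (reshape s X) v ⊎ compIsCycle (reshape s X) v
    components v h with onC v in on
    ... | true  = reshape-components-on s compat v on
    ... | false with sachs-off v h on
    ...   | inj₁ k2 = inj₁ (trans (count-cong λ u → reach-reshape-off compat s v u on) k2)
    ...   | inj₂ cy = inj₂ λ u r →
      let r′ = trans (≡.sym (reach-reshape-off compat s v u on)) r
          off-u = reach-closed X offC (offC-closed compat) (cong not on) r′
      in trans (deg-reshape-off compat s u (not-injective off-u)) (cy u r′)

  isCycleRep : Sub n → Fin n → Bool
  isCycleRep X v = isRep X v ∧ compIsCycleB X v

  module _ {X : Sub n} (compat : Compatible X) (s : Shape) where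
    open Compatible compat

    isRep-reshape-on : ∀ v → onC v ≡ true → isRep (reshape s X) v ≡ isRep (shapeGraph s) v
    isRep-reshape-on v on = isRep-cong (trans (onC⊆vs v on) (≡.sym on)) λ u → reach-reshape-on compat s v u on

    isRep-reshape-off : ∀ v → onC v ≡ false → isRep (reshape s X) v ≡ isRep X v
    isRep-reshape-off v off = isRep-cong refl λ u → reach-reshape-off compat s v u off

    isRep-reshape : ∀ v → isRep (reshape s X) v ≡ (if onC v then isRep (shapeGraph s) v else isRep X v)
    isRep-reshape v = if-split (onC v) (isRep-reshape-on v) (isRep-reshape-off v)

    isCycleRep-reshape : ∀ v →
      isCycleRep (reshape s X) v ≡ (if onC v then isCycleRep (shapeGraph s) v else isCycleRep X v)
    isCycleRep-reshape v = if-split (onC v)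
      (λ on → cong₂ _∧_ (isRep-reshape-on v on)
        (compIsCycleB-cong (λ u → reach-reshape-on compat s v u on) λ u r →
          let on-u = reach-closed (reshape s X) onC (onC-closed s X) on r
          in trans (deg-reshape-on s X u on-u) (≡.sym (deg-reshape-on s bare u on-u))))
      (λ off → cong₂ _∧_ (isRep-reshape-off v off)
        (compIsCycleB-cong (λ u → reach-reshape-off compat s v u off) λ u r →
          let off-u = reach-closed X offC (offC-closed compat) (cong not off)
                        (trans (≡.sym (reach-reshape-off compat s v u off)) r)
          in deg-reshape-off compat s u (not-injective off-u)))

    o-reshape : o (reshape s X) ≡ o (shapeGraph s) Nat.+ count (λ v → offC v ∧ isRep X v)
    o-reshape = trans (count-cong isRep-reshape)
      (trans (count-if onC _ _) (cong (Nat._+ _) (count-restrict (isRep⇒vs (shapeGraph s)))))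

    c-reshape : c (reshape s X) ≡ c (shapeGraph s) Nat.+ count (λ v → offC v ∧ isCycleRep X v)
    c-reshape = trans (count-cong isCycleRep-reshape)
      (trans (count-if onC _ _) (cong (Nat._+ _) (count-restrict λ v r → isRep⇒vs (shapeGraph s) v (∧-trueˡ r))))

  o-perfect : ∀ m → o (shapeGraph (perfect m)) ≡ 2
  o-perfect m = o-two-components (matchedComponent m c₀) (matchedComponent m (otherEdge m)) cover disjoint
    where
    cover : ∀ v → onC v ≡ true → liftP (matched m c₀) v ∨ liftP (matched m (otherEdge m)) v ≡ true
    cover v on with cornerView v
    ... | outside out   = ⊥-elim (true≢false on (onC-outside v out))
    ... | corner y refl rewrite liftP-ι (matched m c₀) y | liftP-ι (matched m (otherEdge m)) y
                              | matched-otherEdge m y = ∨-inverseʳ (matched m c₀ y)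
    disjoint : ∀ v → liftP (matched m c₀) v ∧ liftP (matched m (otherEdge m)) v ≡ false
    disjoint v with cornerView v
    ... | outside out   = cong (_∧ liftP (matched m (otherEdge m)) v) (liftP-outside (matched m c₀) v out)
    ... | corner y refl rewrite liftP-ι (matched m c₀) y | liftP-ι (matched m (otherEdge m)) y
                              | matched-otherEdge m y = ∧-inverseʳ (matched m c₀ y)

  c-perfect : ∀ m → c (shapeGraph (perfect m)) ≡ 0
  c-perfect m = count-false no-cycle
    where
    K : Sub n
    K = shapeGraph (perfect m)
    deg≤1 : ∀ x → deg K (ι x) ≤ 1
    deg≤1 x = count-≤1 (ι (partner m x)) λ w h →
      let (y , w≡ , xy) = shapeGraph-neighbour (perfect m) x w h in trans w≡ (cong ι (perfect-unique m x y xy))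
    ≤1⇒≢ᵇ2 : ∀ {d} → d ≤ 1 → (d ≡ᵇ 2) ≡ false
    ≤1⇒≢ᵇ2 z≤n       = refl
    ≤1⇒≢ᵇ2 (s≤s z≤n) = refl
    no-cycle : ∀ v → isCycleRep K v ≡ false
    no-cycle v with cornerView v
    ... | outside out   = cong (λ b → (b ∧ not (any (λ u → (u <F v) ∧ reach K v u) (allFin n))) ∧ compIsCycleB K v)
                                 (onC-outside v out)
    ... | corner x refl = trans (cong (isRep K (ι x) ∧_)
        (all-allFin-false (ι x) (cong₂ (λ r b → not r ∨ b) (reach-refl K (onC-ι x)) (≤1⇒≢ᵇ2 (deg≤1 x)))))
      (∧-zeroʳ _)

  o-cycle : o (shapeGraph cycle) ≡ 1
  o-cycle = o-one-component cycleComponent λ _ on → on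

  c-cycle : c (shapeGraph cycle) ≡ 1
  c-cycle = trans (count-cong every-rep-is-cycle) o-cycle
    where
    K : Sub n
    K = shapeGraph cycle
    all-degree-2 : ∀ v → onC v ≡ true → compIsCycleB K v ≡ true
    all-degree-2 v on = all-intro (allFin n) λ u → case-bool (reach K v u)
      (λ r → let on-u = reach-closed K onC (onC-closed cycle bare) on r in
             ∨-trueʳ {not (reach K v u)} (cong (_≡ᵇ 2) (trans (deg-reshape-on cycle bare u on-u) (deg-cycle u on-u))))
      (λ ¬r → ∨-trueˡ (cong not ¬r))
    every-rep-is-cycle : ∀ v → isCycleRep K v ≡ isRep K v
    every-rep-is-cycle v = case-bool (isRep K v)
      (λ r → trans (cong₂ _∧_ r (all-degree-2 v (isRep⇒vs K v r))) (≡.sym r))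
      (λ ¬r → trans (cong (_∧ compIsCycleB K v) ¬r) (≡.sym ¬r))

  reshape-weights-cancel : ∀ {X} → Compatible X →
    weight (reshape (perfect M₀₁) X) + weight (reshape (perfect M₁₂) X) + weight (reshape cycle X) ≡ + 0
  reshape-weights-cancel {X} compat = begin
    weight (reshape (perfect M₀₁) X) + weight (reshape (perfect M₁₂) X) + weight (reshape cycle X)
      ≡⟨ cong₂ _+_ (cong₂ _+_ (weight-reshape (perfect M₀₁) (o-perfect M₀₁) (c-perfect M₀₁))
                              (weight-reshape (perfect M₁₂) (o-perfect M₁₂) (c-perfect M₁₂)))
                   (weight-reshape cycle o-cycle c-cycle) ⟩
    -1ℤ * (-1ℤ * σ) * + 2^B + -1ℤ * (-1ℤ * σ) * + 2^B + -1ℤ * σ * + (2 Nat.* 2^B)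
      ≡⟨ cong (λ t → -1ℤ * (-1ℤ * σ) * + 2^B + -1ℤ * (-1ℤ * σ) * + 2^B + -1ℤ * σ * t) (ℤ.pos-* 2 2^B) ⟩
    -1ℤ * (-1ℤ * σ) * + 2^B + -1ℤ * (-1ℤ * σ) * + 2^B + -1ℤ * σ * (+ 2 * + 2^B)
      ≡⟨ cancel σ (+ 2^B) ⟩
    + 0 ∎
    where
    A : ℕ
    A = count (λ v → offC v ∧ isRep X v)
    B : ℕ
    B = count (λ v → offC v ∧ isCycleRep X v)
    σ : ℤ
    σ = -1ℤ ^ A
    2^B : ℕ
    2^B = 2 Nat.^ B
    weight-reshape : ∀ s {oₛ cₛ} → o (shapeGraph s) ≡ oₛ → c (shapeGraph s) ≡ cₛ →
      weight (reshape s X) ≡ (-1ℤ ^ (oₛ Nat.+ A)) * + (2 Nat.^ (cₛ Nat.+ B))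
    weight-reshape s o≡ c≡ = cong₂ (λ a b → (-1ℤ ^ a) * + (2 Nat.^ b))
      (trans (o-reshape compat s) (cong (Nat._+ A) o≡)) (trans (c-reshape compat s) (cong (Nat._+ B) c≡))
    cancel : ∀ σ t → -1ℤ * (-1ℤ * σ) * t + -1ℤ * (-1ℤ * σ) * t + -1ℤ * σ * (+ 2 * t) ≡ + 0
    cancel = solve-∀

  es-C-ι : ∀ x y → es C (ι x) (ι y) ≡ cycleEdge x y
  es-C-ι x y = trans (es-C (ι x) (ι y)) (liftC-ι cycleEdge x y)

  C-neighbour : ∀ x w → es C (ι x) w ≡ true → ∃ λ y → w ≡ ι y × cycleEdge x y ≡ true
  C-neighbour x w h = liftC-at-ι cycleEdge x w (trans (≡.sym (es-C (ι x) w)) h)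

  three⇒¬K2 : ∀ {X : Sub n} {v a b c} → a ≢ b → a ≢ c → b ≢ c →
    reach X v a ≡ true → reach X v b ≡ true → reach X v c ≡ true → ¬ compIsK2 X v
  three⇒¬K2 {X} {v} a≢b a≢c b≢c ra rb rc k2 =
    ℕ.<-irrefl (≡.sym k2)
      (length≤count {p = reach X v} ((a≢b ∷ a≢c ∷ []) ∷ (b≢c ∷ []) ∷ [] ∷ []) (ra ∷ rb ∷ rc ∷ []))

  module Member (r : ℕ) {H : Sub n} (H∈ : InH G C r H) where
    private
      H-sachs : IsSachs G (2 Nat.* r) H
      H-sachs = proj₁ H∈
      I-sachs : IsSachs G (2 Nat.* 2) (C ∩S H)
      I-sachs = proj₁ (proj₂ H∈)
      U-sachs : IsSachs G (2 Nat.* r) (C ∪S H)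
      U-sachs = proj₂ (proj₂ H∈)
      H⊆G : IsSubgraph G H
      H⊆G = proj₁ H-sachs
      I : Sub n
      I = C ∩S H
      U : Sub n
      U = C ∪S H

      ι-≢ : ∀ {x y} → x ≢ y → ι x ≢ ι y
      ι-≢ x≢y = x≢y ∘ ι-injective

      on-C : ∀ x → vs C (ι x) ≡ true
      on-C x = trans (vs-C (ι x)) (onC-ι x)

    onC⊆H : ∀ u → onC u ≡ true → vs H u ≡ true
    onC⊆H u on = ∧-trueʳ {vs C u} (count-⊆-≡ {p = λ v → vs C v ∧ vs H v} (λ _ → ∧-trueˡ)
                   (trans (proj₁ (proj₂ I-sachs)) (≡.sym order-C)) u (trans (vs-C u) on))

    -- The component of ι x in C ∪ H contains both C-neighbours of ι x, so it is a cycle.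
    H-edge-at-corner : ∀ x w → es H (ι x) w ≡ true → es C (ι x) w ≡ true
    H-edge-at-corner x w h with proj₂ (proj₂ U-sachs) (ι x) (∨-trueˡ (on-C x))
    ... | inj₁ k2 = ⊥-elim (three⇒¬K2 (ι-≢ (partner-≢ M₀₁ x)) (ι-≢ (partner-≢ M₁₂ x)) (ι-≢ (partners-≢ x))
                              (reach-refl U (∨-trueˡ (on-C x))) (C-edge M₀₁) (C-edge M₁₂) k2)
      where
      C-edge : ∀ m → reach U (ι x) (ι (partner m x)) ≡ true
      C-edge m = reach-edge U (∨-trueˡ (on-C x)) (∨-trueˡ (trans (es-C-ι x (partner m x)) (cycleEdge-partner m x)))
    ... | inj₂ cy = count-⊆-≡ {p = es C (ι x)} {q = es U (ι x)} (λ _ → ∨-trueˡ)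
                      (trans (deg-C (ι x) (on-C x)) (≡.sym (cy (ι x) (reach-refl U (∨-trueˡ (on-C x))))))
                      w (∨-trueʳ {es C (ι x) w} h)

    H-edge-at-onC : ∀ u w → onC u ≡ true → es H u w ≡ true → es C u w ≡ true
    H-edge-at-onC u w on h with cornerView u
    ... | corner x refl = H-edge-at-corner x w h
    ... | outside out   = ⊥-elim (true≢false on (onC-outside u out))

    compatible : Compatible H
    compatible = record
      { subgraph    = H⊆G
      ; onC⊆vs      = onC⊆H
      ; no-crossing = λ u v off on → ≢true⇒≡false λ h →
          true≢false (liftC⇒onCʳ cycleEdge v u (trans (≡.sym (es-C v u))
                        (H-edge-at-onC v u on (trans (IsSubgraph.es-sym H⊆G v u) h)))) off
      ; sachs-off   = λ v h _ → proj₂ (proj₂ H-sachs) v h }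

    corner-edge : Corner → Corner → Bool
    corner-edge x y = es H (ι x) (ι y)

    private
      corner-edge-sym : ∀ x y → corner-edge x y ≡ corner-edge y x
      corner-edge-sym x y = IsSubgraph.es-sym H⊆G (ι x) (ι y)

      corner-edge⊆cycle : ∀ x y → corner-edge x y ≡ true → cycleEdge x y ≡ true
      corner-edge⊆cycle x y h = trans (≡.sym (es-C-ι x y)) (H-edge-at-corner x (ι y) h)

      on-I : ∀ x → vs I (ι x) ≡ true
      on-I x = ∧-true (on-C x) (onC⊆H (ι x) (onC-ι x))

      I-edge : ∀ {x y} → corner-edge x y ≡ true → es I (ι x) (ι y) ≡ true
      I-edge {x} {y} h = ∧-true (trans (es-C-ι x y) (corner-edge⊆cycle x y h)) h

      I-neighbour : ∀ x w → es I (ι x) w ≡ true → ∃ λ y → w ≡ ι y × corner-edge x y ≡ true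
      I-neighbour x w h with C-neighbour x w (∧-trueˡ h)
      ... | y , refl , _ = y , refl , ∧-trueʳ {es C (ι x) (ι y)} h

      -- An isolated vertex is neither a K₂ nor a cycle.
      covers : ∀ x → ∃ λ y → corner-edge x y ≡ true
      covers x = case-bool (any (es I (ι x)) (allFin n))
        (λ some → let (w , h) = any-elim (allFin n) some ; (y , _ , xy) = I-neighbour x w h in y , xy)
        (λ none → ⊥-elim (isolated (λ w h → true≢false (any-intro (∈-allFin w) h) none)))
        where
        isolated : (∀ w → es I (ι x) w ≡ true → ⊥) → ⊥
        isolated no-edge with proj₂ (proj₂ I-sachs) (ι x) (on-I x)
        ... | inj₁ k2 = ℕ.<-irrefl k2 (s≤s (count-≤1 (ι x) λ w r →
              ==F⇒≡ (reach-closed I (_==F ι x) stuck (==F-refl (ι x)) r)))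
          where
          stuck : ∀ u w → (u ==F ι x) ≡ true → es I u w ≡ true → (w ==F ι x) ≡ true
          stuck u w u≡ e = ⊥-elim (no-edge w (subst (λ z → es I z w ≡ true) (==F⇒≡ u≡) e))
        ... | inj₂ cy = case trans (≡.sym (cy (ι x) (reach-refl I (on-I x))))
                                   (count-false λ w → ≢true⇒≡false (no-edge w)) of λ ()

      no-pendant-walk : ∀ x y z → (∀ y′ → corner-edge x y′ ≡ true → y′ ≡ y) → corner-edge x y ≡ true →
        corner-edge y z ≡ true → z ≢ x → ⊥
      no-pendant-walk x y z only-y xy yz z≢x with proj₂ (proj₂ I-sachs) (ι x) (on-I x)
      ... | inj₁ k2 = three⇒¬K2 (ι-≢ (adjacent-≢ xy)) (ι-≢ (z≢x ∘ ≡.sym)) (ι-≢ (adjacent-≢ yz))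
                        (reach-refl I (on-I x)) (reach-edge I (on-I x) (I-edge xy))
                        (reach-path₂ I 2≤n {ι x} {ι y} (on-I x) (I-edge xy) (I-edge yz)) k2
        where
        adjacent-≢ : ∀ {a b} → corner-edge a b ≡ true → a ≢ b
        adjacent-≢ {a} h refl = true≢false (corner-edge⊆cycle a a h) (cycleEdge-irrefl a)
      ... | inj₂ cy = ℕ.<-irrefl (cy (ι x) (reach-refl I (on-I x)))
                        (s≤s (count-≤1 (ι y) λ w h →
                          let (y′ , w≡ , xy′) = I-neighbour x w h in trans w≡ (cong ι (only-y y′ xy′))))

    open Classification corner-edge corner-edge-sym corner-edge⊆cycle covers no-pendant-walk
      using (shape; e≡shapeEdge) public

    ≈-reshape-shape : H ≈ reshape shape H
    ≈-reshape-shape = (λ _ → refl) , λ u v → if-split (onC u ∨ onC v) (at-C u v) (λ _ → refl)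
      where
      at-corner : ∀ x v → es H (ι x) v ≡ liftC (shapeEdge shape) (ι x) v
      at-corner x v with cornerView v
      ... | corner y refl = trans (e≡shapeEdge x y) (≡.sym (liftC-ι (shapeEdge shape) x y))
      ... | outside out   = trans
        (≢true⇒≡false λ h → true≢false (H-edge-at-corner x v h)
                                       (trans (es-C (ι x) v) (liftC-outsideʳ cycleEdge (ι x) v out)))
        (≡.sym (liftC-outsideʳ (shapeEdge shape) (ι x) v out))
      at-onC : ∀ u v → onC u ≡ true → es H u v ≡ liftC (shapeEdge shape) u v
      at-onC u v on with cornerView u
      ... | corner x refl = at-corner x v
      ... | outside out   = ⊥-elim (true≢false on (onC-outside u out))
      at-C : ∀ u v → onC u ∨ onC v ≡ true → es H u v ≡ liftC (shapeEdge shape) u v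
      at-C u v on with ∨-true on
      ... | inj₁ on-u = at-onC u v on-u
      ... | inj₂ on-v = trans (IsSubgraph.es-sym H⊆G u v)
                              (trans (at-onC v u on-v) (liftC-sym (shapeEdge-sym shape) v u))

  reshape-cong : ∀ s {X Y} → X ≈ Y → reshape s X ≈ reshape s Y
  reshape-cong s (vs≡ , es≡) = vs≡ , λ u v → cong (if onC u ∨ onC v then liftC (shapeEdge s) u v else_) (es≡ u v)

  reshape-idem : ∀ s t X → reshape s (reshape t X) ≈ reshape s X
  reshape-idem s t X = (λ _ → refl) , edges
    where
    edges : ∀ u v → es (reshape s (reshape t X)) u v ≡ es (reshape s X) u v
    edges u v with onC u ∨ onC v
    ... | true  = refl
    ... | false = refl

  reshape-injective : ∀ s t {X Y} → reshape s X ≈ reshape t Y → s ≡ t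
  reshape-injective s t {X} {Y} (_ , es≡) =
    trans (≡.sym (shapeFrom-shapeEdge s)) (trans (cong₂ shapeFrom (edge c₀ c₁) (edge c₁ c₂)) (shapeFrom-shapeEdge t))
    where
    at-ι : ∀ s Z x y → es (reshape s Z) (ι x) (ι y) ≡ shapeEdge s x y
    at-ι s Z x y = trans (es-reshape-on s Z (ι x) (ι y) (onC-ι x)) (liftC-ι (shapeEdge s) x y)
    edge : ∀ x y → shapeEdge s x y ≡ shapeEdge t x y
    edge x y = trans (≡.sym (at-ι s X x y)) (trans (es≡ (ι x) (ι y)) (at-ι t Y x y))

  order-bare : order bare ≡ 4
  order-bare = trans (count-cong λ v → ≡.sym (vs-C v)) order-C

  module _ (r : ℕ) {H : Sub n} (H∈ : InH G C r H) where
    open Member r H∈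

    C∩reshape≈shapeGraph : ∀ s → (C ∩S reshape s H) ≈ shapeGraph s
    C∩reshape≈shapeGraph s = (λ v → trans (cong (_∧ vs H v) (vs-C v)) (∧-⇒-absorb (onC⊆H v))) , edges
      where
      edges : ∀ u v → es C u v ∧ es (reshape s H) u v ≡ es (shapeGraph s) u v
      edges u v rewrite es-C u v with onC u ∨ onC v in c
      ... | true  = ≡.trans (∧-comm (liftC cycleEdge u v) _) (∧-⇒-absorb (liftC-mono (shapeEdge⇒cycleEdge s) u v))
      ... | false = cong (_∧ es H u v) (liftC-offˡ cycleEdge u v (∨-conicalˡ (onC u) (onC v) c))

    C∪reshape≈reshape-cycle : ∀ s → (C ∪S reshape s H) ≈ reshape cycle H
    C∪reshape≈reshape-cycle s = (λ v → ∨-⇒-absorb λ h → onC⊆H v (trans (≡.sym (vs-C v)) h)) , edges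
      where
      edges : ∀ u v → es C u v ∨ es (reshape s H) u v ≡ es (reshape cycle H) u v
      edges u v rewrite es-C u v with onC u ∨ onC v in c
      ... | true  = ≡.trans (∨-comm (liftC cycleEdge u v) _) (∨-⇒-absorb (liftC-mono (shapeEdge⇒cycleEdge s) u v))
      ... | false = cong (_∨ es H u v) (liftC-offˡ cycleEdge u v (∨-conicalˡ (onC u) (onC v) c))

    reshape-InH : ∀ s → InH G C r (reshape s H)
    reshape-InH s =
      sachs s ,
      IsSachs-≈ (≈-sym (C∩reshape≈shapeGraph s))
        (subst (λ k → IsSachs G k (shapeGraph s)) order-bare (reshape-IsSachs s bare-compatible)) ,
      IsSachs-≈ (≈-sym (C∪reshape≈reshape-cycle s)) (sachs cycle)
      where
      sachs : ∀ s → IsSachs G (2 Nat.* r) (reshape s H)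
      sachs s = subst (λ k → IsSachs G k (reshape s H)) (proj₁ (proj₂ (proj₁ H∈))) (reshape-IsSachs s compatible)

  reshape-orbit-sym : ∀ r {H K} → InH G C r H → ∀ t → K ≈ reshape t H → ∃ λ s → H ≈ reshape s K
  reshape-orbit-sym r H∈ t K≈ = shape , ≈-trans ≈-reshape-shape
    (≈-trans (≈-sym (reshape-idem shape t _)) (reshape-cong shape (≈-sym K≈)))
    where open Member r H∈

  ∑-weight-vanishes : ∀ r L → Enumerates (InH G C r) L → sumℤ (map weight L) ≡ + 0
  ∑-weight-vanishes r L (L-sound , L-complete , L-distinct) =
    TripleCancellation.∑-vanishes subDecSetoid (InH G C r) weight weight-≈
      (reshape (perfect M₀₁)) (reshape (perfect M₁₂)) (reshape cycle)
      (λ H∈ → reshape-InH r H∈ (perfect M₀₁)) (λ H∈ → reshape-InH r H∈ (perfect M₁₂))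
      (λ H∈ → reshape-InH r H∈ cycle)
      (λ H∈ → reshape-weights-cancel (Member.compatible r H∈))
      (λ _ e → case reshape-injective _ _ e of λ ()) (λ _ e → case reshape-injective _ _ e of λ ())
      (λ _ e → case reshape-injective _ _ e of λ ())
      orbit-sym L L-sound L-complete L-distinct
    where
    in-orbit : ∀ {H K} s → K ≈ reshape s H →
      K ≈ reshape (perfect M₀₁) H ⊎ K ≈ reshape (perfect M₁₂) H ⊎ K ≈ reshape cycle H
    in-orbit (perfect M₀₁) e = inj₁ e
    in-orbit (perfect M₁₂) e = inj₂ (inj₁ e)
    in-orbit cycle         e = inj₂ (inj₂ e)
    orbit-sym : ∀ {H K} → InH G C r H → InH G C r K →
      K ≈ reshape (perfect M₀₁) H ⊎ K ≈ reshape (perfect M₁₂) H ⊎ K ≈ reshape cycle H →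
      H ≈ reshape (perfect M₀₁) K ⊎ H ≈ reshape (perfect M₁₂) K ⊎ H ≈ reshape cycle K
    orbit-sym H∈ _ (inj₁ e)        = let (s , e′) = reshape-orbit-sym r H∈ (perfect M₀₁) e in in-orbit s e′
    orbit-sym H∈ _ (inj₂ (inj₁ e)) = let (s , e′) = reshape-orbit-sym r H∈ (perfect M₁₂) e in in-orbit s e′
    orbit-sym H∈ _ (inj₂ (inj₂ e)) = let (s , e′) = reshape-orbit-sym r H∈ cycle e in in-orbit s e′

-- Locating the corners of C

record CornerPlacement {n} (C : Sub n) : Set where
  field
    ι           : Corner → Fin n
    ι-injective : ∀ {x y} → ι x ≡ ι y → x ≡ y
    vs-C        : ∀ u → vs C u ≡ Corners.onC ι ι-injective u
    es-C        : ∀ u v → es C u v ≡ Corners.liftC ι ι-injective cycleEdge u v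

≢-≢⇒≡ : ∀ {x y z : Bool} → x ≢ y → y ≢ z → x ≡ z
≢-≢⇒≡ {true}  {true}          x≢y _   = ⊥-elim (x≢y refl)
≢-≢⇒≡ {false} {false}         x≢y _   = ⊥-elim (x≢y refl)
≢-≢⇒≡ {true}  {false} {true}  _   _   = refl
≢-≢⇒≡ {false} {true}  {false} _   _   = refl
≢-≢⇒≡ {true}  {false} {false} _   y≢z = ⊥-elim (y≢z refl)
≢-≢⇒≡ {false} {true}  {true}  _   y≢z = ⊥-elim (y≢z refl)

module Neighbours {n} {G : Graph n} {C : Sub n} (C⊆G : IsSubgraph G C) where
  open IsSubgraph C⊆G

  sym-edge : ∀ {u v} → es C u v ≡ true → es C v u ≡ true
  sym-edge {u} {v} h = trans (es-sym v u) h

  on-C : ∀ {u v} → es C u v ≡ true → vs C v ≡ true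
  on-C h = es-vs _ _ (sym-edge h)

-- Bipartiteness gives c ≢ d and e ≢ a, so the walk a b c e in C, never turning back, closes up at e = d.
module Quadrilateral {n} {G : Graph n} (bip : Bipartite G) {C : Sub n} (C⊆G : IsSubgraph G C)
  (deg-C : ∀ u → vs C u ≡ true → deg C u ≡ 2) (order-C : order C ≡ 4)
  {a b c d e : Fin n} (a∈C : vs C a ≡ true) (ab : es C a b ≡ true) (ad : es C a d ≡ true) (d≢b : d ≢ b)
  (bc : es C b c ≡ true) (c≢a : c ≢ a) (ce : es C c e ≡ true) (e≢b : e ≢ b) where
  open IsSubgraph C⊆G
  open Neighbours C⊆G

  private
    col : Fin n → Bool
    col = proj₁ bip

    col-≢ : ∀ {u v} → es C u v ≡ true → col u ≢ col v
    col-≢ {u} {v} h = proj₂ bip u v (es-adj u v h)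

    ≢-edge : ∀ {u v} → es C u v ≡ true → u ≢ v
    ≢-edge {u} h refl = true≢false (es-adj u u h) (Graph.irrefl G u)

    col-a≡col-c : col a ≡ col c
    col-a≡col-c = ≢-≢⇒≡ (col-≢ ab) (col-≢ bc)

    c≢d : c ≢ d
    c≢d refl = col-≢ ad col-a≡col-c

    abcd-unique : Unique (a ∷ b ∷ c ∷ d ∷ [])
    abcd-unique = (≢-edge ab ∷ (c≢a ∘ ≡.sym) ∷ ≢-edge ad ∷ [])
                ∷ (≢-edge bc ∷ (d≢b ∘ ≡.sym) ∷ [])
                ∷ (c≢d ∷ []) ∷ [] ∷ []

    in-C : ∀ u → vs C u ≡ true → u ∈ a ∷ b ∷ c ∷ d ∷ []
    in-C = count≡length⇒∈ order-C abcd-unique (a∈C ∷ on-C ab ∷ on-C bc ∷ on-C ad ∷ [])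

    e≡d : e ≡ d
    e≡d with in-C e (on-C ce)
    ... | here refl                         = ⊥-elim (col-≢ ce (≡.sym col-a≡col-c))
    ... | there (here e≡b)                  = ⊥-elim (e≢b e≡b)
    ... | there (there (here refl))         = ⊥-elim (≢-edge ce refl)
    ... | there (there (there (here e≡d))) = e≡d

    cd : es C c d ≡ true
    cd = subst (λ z → es C c z ≡ true) e≡d ce

  ι : Corner → Fin n
  ι c₀ = a
  ι c₁ = b
  ι c₂ = c
  ι c₃ = d

  ι-injective : ∀ {x y} → ι x ≡ ι y → x ≡ y
  ι-injective {c₀} {c₀} _ = refl
  ι-injective {c₁} {c₁} _ = refl
  ι-injective {c₂} {c₂} _ = refl
  ι-injective {c₃} {c₃} _ = refl
  ι-injective {c₀} {c₁} e = ⊥-elim (≢-edge ab e)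
  ι-injective {c₀} {c₂} e = ⊥-elim (c≢a (≡.sym e))
  ι-injective {c₀} {c₃} e = ⊥-elim (≢-edge ad e)
  ι-injective {c₁} {c₀} e = ⊥-elim (≢-edge ab (≡.sym e))
  ι-injective {c₁} {c₂} e = ⊥-elim (≢-edge bc e)
  ι-injective {c₁} {c₃} e = ⊥-elim (d≢b (≡.sym e))
  ι-injective {c₂} {c₀} e = ⊥-elim (c≢a e)
  ι-injective {c₂} {c₁} e = ⊥-elim (≢-edge bc (≡.sym e))
  ι-injective {c₂} {c₃} e = ⊥-elim (c≢d e)
  ι-injective {c₃} {c₀} e = ⊥-elim (≢-edge ad (≡.sym e))
  ι-injective {c₃} {c₁} e = ⊥-elim (d≢b e)
  ι-injective {c₃} {c₂} e = ⊥-elim (c≢d (≡.sym e))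

  open Corners ι ι-injective

  private
    edge-partner : ∀ m x → es C (ι x) (ι (partner m x)) ≡ true
    edge-partner M₀₁ c₀ = ab
    edge-partner M₀₁ c₁ = sym-edge ab
    edge-partner M₀₁ c₂ = cd
    edge-partner M₀₁ c₃ = sym-edge cd
    edge-partner M₁₂ c₀ = ad
    edge-partner M₁₂ c₁ = bc
    edge-partner M₁₂ c₂ = sym-edge bc
    edge-partner M₁₂ c₃ = sym-edge ad

    on-C-ι : ∀ x → vs C (ι x) ≡ true
    on-C-ι x = on-C (sym-edge (edge-partner M₀₁ x))

  vs-C : ∀ u → vs C u ≡ onC u
  vs-C u = true⇔true⇒≡ to from
    where
    to : vs C u ≡ true → onC u ≡ true
    to h with in-C u h
    ... | here refl                         = onC-ι c₀
    ... | there (here refl)                 = onC-ι c₁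
    ... | there (there (here refl))         = onC-ι c₂
    ... | there (there (there (here refl))) = onC-ι c₃
    from : onC u ≡ true → vs C u ≡ true
    from on with cornerView u
    ... | corner x refl = on-C-ι x
    ... | outside out   = ⊥-elim (true≢false on (onC-outside u out))

  es-C : ∀ u v → es C u v ≡ liftC cycleEdge u v
  es-C u v = true⇔true⇒≡ to from
    where
    to : es C u v ≡ true → liftC cycleEdge u v ≡ true
    to h with cornerView u
    ... | outside out   = ⊥-elim (true≢false (trans (≡.sym (vs-C u)) (es-vs u v h)) (onC-outside u out))
    ... | corner x refl with count≡length⇒∈ (deg-C (ι x) (on-C-ι x))
                               ((ι-≢ (partners-≢ x) ∷ []) ∷ [] ∷ []) (edge-partner M₀₁ x ∷ edge-partner M₁₂ x ∷ []) v h
      where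
      ι-≢ : ∀ {y z} → y ≢ z → ι y ≢ ι z
      ι-≢ y≢z = y≢z ∘ ι-injective
    ...   | here refl         = trans (liftC-ι cycleEdge x _) (cycleEdge-partner M₀₁ x)
    ...   | there (here refl) = trans (liftC-ι cycleEdge x _) (cycleEdge-partner M₁₂ x)
    from : liftC cycleEdge u v ≡ true → es C u v ≡ true
    from h with cornerView u
    ... | outside out   = ⊥-elim (true≢false h (liftC-outsideˡ cycleEdge u v out))
    ... | corner x refl with liftC-at-ι cycleEdge x v h
    ...   | y , refl , xy with cycle-neighbours x y xy
    ...     | inj₁ refl = edge-partner M₀₁ x
    ...     | inj₂ refl = edge-partner M₁₂ x

  placement : CornerPlacement C
  placement = record { ι = ι ; ι-injective = ι-injective ; vs-C = vs-C ; es-C = es-C }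

cornerPlacement : ∀ {n} {G : Graph n} → Bipartite G → ∀ {C} → IsSubgraph G C → IsCycle C → order C ≡ 4 →
  CornerPlacement C
cornerPlacement bip {C} C⊆G ((a , a∈C) , _ , deg-C) order-C
  with count-pos {p = es C a} {k = 1} (deg-C a a∈C)
... | b , ab with count≡2⇒other (deg-C a a∈C) ab
... | d , d≢b , ad with count≡2⇒other (deg-C b (Neighbours.on-C C⊆G ab)) (Neighbours.sym-edge C⊆G ab)
... | c , c≢a , bc with count≡2⇒other (deg-C c (Neighbours.on-C C⊆G bc)) (Neighbours.sym-edge C⊆G bc)
... | e , e≢b , ce = Quadrilateral.placement bip C⊆G deg-C order-C a∈C ab ad d≢b bc c≢a ce e≢b

-- The hypothesis 2 ≤ r is unused: for r < 2 no subgraph qualifies, and the argument needs no case split.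
lemma4p1 : (n : ℕ) (G : Graph n) → Bipartite G
    → (C : Sub n) → IsSubgraph G C → IsCycle C → order C ≡ 4
    → (r : ℕ) → 2 ≤ r
    → (L : List (Sub n)) → Enumerates (InH G C r) L
    → sumℤ (map weight L) ≡ + 0
lemma4p1 n G bip C C⊆G cycle-C order-C r _ L L-enumerates =
  OnCycle.∑-weight-vanishes G C C⊆G ι ι-injective vs-C es-C (proj₂ (proj₂ cycle-C)) order-C r L L-enumerates
  where open CornerPlacement (cornerPlacement bip C⊆G cycle-C order-C)
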